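{- Let $a$ be a weak composition with exactly two nonzero parts and exactly one leading zero (that is, $a_1=0\neq a_2$). Then $\kappa_a$ is multiplicity free if and only if either (1) $\mathrm{sort}(a)$ is one of the partitions $(3,3)$, $(4,4)$, $(n-2,2)$ for some $n\ge 4$, or $(n-1,1)$ for some $n\ge 2$; or (2) $\mathrm{flat}(a)=(\alpha_1,\alpha_2)$ with $\alpha_1\ge\alpha_2$.
   Context: A weak composition $a=(a_1,\dots,a_\ell)$ of length $\ell$ is a finite sequence of nonnegative integers. $\mathrm{flat}(a)$ is the sequence obtained by deleting the zeros of $a$, and $\mathrm{sort}(a)$ is the partition obtained by rearranging the parts of $\mathrm{flat}(a)$ in weakly decreasing order. A diagram is a finite set of cells $(r,c)$ with $r,c$ positive integers (row $r$ from the bottom, column $c$ from the left). A Kohnert tableau of content $a$ is a diagram filled with positive integers, exactly $a_i$ cells containing $i$ for each $i$, such that: (i) for each $i$ there is exactly one $i$ in each of the columns $1,\dots,a_i$; (ii) every entry in row $r$ is at least $r$; (iii) for each $i$, the cells containing $i$ weakly descend from left to right; (iv) if $i<j$ appear in the same column with $i$ above $j$, then there is an $i$ in the column immediately to the right of the cell containing that $j$, in a row strictly above it. It is quasi-Yamanouchi if moreover (v) for each nonempty row $r$, either row $r$ contains an entry equal to $r$, or some cell of row $r+1$ lies weakly to the right of some cell of row $r$. Let $\mathrm{QKT}(a)$ be the set of quasi-Yamanouchi Kohnert tableaux of content $a$, and $\mathrm{wt}(T)$ the weak composition of length $\ell$ whose $r$-th part is the number of cells in row $r$ of $T$. The key polynomial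 $\kappa_a$ satisfies $\kappa_a=\sum_{T\in\mathrm{QKT}(a)}\mathfrak{F}_{\mathrm{wt}(T)}$, where $\mathfrak{F}_b$ is the fundamental slide polynomial. We say $\kappa_a$ is multiplicity free if distinct tableaux in $\mathrm{QKT}(a)$ have distinct weights. -}

module Defs where

open import Data.Nat using (ℕ; zero; suc; _+_; _∸_; _≤_; _<_; _≤ᵇ_; _≡ᵇ_)
open import Data.Bool using (Bool; true; false; if_then_else_; _∧_; not)
open import Data.List using (List; []; _∷_; length; map; filterᵇ; upTo)
open import Data.List.Membership.Propositional using (_∈_)
open import Data.List.Relation.Unary.Unique.Propositional using (Unique)
open import Data.Product using (_×_; _,_; Σ; ∃; ∃-syntax; proj₁; proj₂)
open import Data.Sum using (_⊎_)
open import Relation.Binary.PropositionalEquality using (_≡_; _≢_)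

-- Weak compositions are lists of naturals; a_i is 1-indexed.

-- (a ! i) = a_i for 1 ≤ i ≤ length a (and 0 otherwise, never used
-- outside that range in the definitions below).
_!_ : List ℕ → ℕ → ℕ
[]       ! _             = 0
(x ∷ _)  ! 1             = x
(_ ∷ xs) ! suc (suc i)   = xs ! suc i
(_ ∷ _)  ! 0             = 0

oneTo : ℕ → List ℕ
oneTo n = map suc (upTo n)

flat : List ℕ → List ℕ
flat = filterᵇ (λ x → not (x ≡ᵇ 0))

insertDesc : ℕ → List ℕ → List ℕ
insertDesc x []       = x ∷ []
insertDesc x (y ∷ ys) = if y ≤ᵇ x then x ∷ y ∷ ys else y ∷ insertDesc x ys

sortDesc : List ℕ → List ℕ
sortDesc []       = []
sortDesc (x ∷ xs) = insertDesc x (sortDesc xs)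

sort : List ℕ → List ℕ
sort a = sortDesc (flat a)

-- Filled diagrams.  A cell is (row , column , entry); a filled diagram
-- is a finite list of cells with pairwise distinct positions
-- (so it is a finite set of cells, each carrying one entry).

Cell : Set
Cell = ℕ × ℕ × ℕ

row col ent : Cell → ℕ
row (r , c , e) = r
col (r , c , e) = c
ent (r , c , e) = e

pos : Cell → ℕ × ℕ
pos (r , c , e) = (r , c)

Filling : Set
Filling = List Cell

countEnt : ℕ → Filling → ℕ
countEnt i T = length (filterᵇ (λ x → ent x ≡ᵇ i) T)

countEntCol : ℕ → ℕ → Filling → ℕ
countEntCol i c T = length (filterᵇ (λ x → (ent x ≡ᵇ i) ∧ (col x ≡ᵇ c)) T)

countRow : ℕ → Filling → ℕ
countRow r T = length (filterᵇ (λ x → row x ≡ᵇ r) T)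

wt : List ℕ → Filling → List ℕ
wt a T = map (λ r → countRow r T) (oneTo (length a))

IsFilledDiagram : Filling → Set
IsFilledDiagram T =
  Unique (map pos T) ×
  (∀ {x} → x ∈ T → 1 ≤ row x × 1 ≤ col x × 1 ≤ ent x)

IsKohnertTableau : List ℕ → Filling → Set
IsKohnertTableau a T =
  IsFilledDiagram T ×
  (∀ {x} → x ∈ T → ent x ≤ length a) ×
  (∀ i → 1 ≤ i → i ≤ length a → countEnt i T ≡ a ! i) ×
  -- (i) exactly one i in each of the columns 1..a_i
  (∀ i → 1 ≤ i → i ≤ length a → ∀ c → 1 ≤ c → c ≤ a ! i →
     countEntCol i c T ≡ 1) ×
  -- (ii) every entry in row r is at least r
  (∀ {x} → x ∈ T → row x ≤ ent x) ×
  -- (iii) cells containing i weakly descend from left to right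
  (∀ {x y} → x ∈ T → y ∈ T → ent x ≡ ent y → col x < col y →
     row y ≤ row x) ×
  -- (iv) i < j in same column, i above j  ⇒  an i in the next column
  --      strictly above the j
  (∀ {x y} → x ∈ T → y ∈ T → ent x < ent y → col x ≡ col y →
     row y < row x →
     ∃[ z ] (z ∈ T × ent z ≡ ent x × col z ≡ suc (col y) × row y < row z))

-- (v) quasi-Yamanouchi condition
IsQuasiYamanouchi : Filling → Set
IsQuasiYamanouchi T =
  ∀ r → (∃[ x ] (x ∈ T × row x ≡ r)) →
    (∃[ x ] (x ∈ T × row x ≡ r × ent x ≡ r)) ⊎
    (∃[ x ] ∃[ y ] (x ∈ T × y ∈ T × row x ≡ r × row y ≡ suc r × col x ≤ col y))

QKT : List ℕ → Filling → Set
QKT a T = IsKohnertTableau a T × IsQuasiYamanouchi T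

SameTableau : Filling → Filling → Set
SameTableau T T' = ∀ x → (x ∈ T → x ∈ T') × (x ∈ T' → x ∈ T)

-- κ_a is multiplicity free: distinct tableaux in QKT(a) have distinct weights
MultiplicityFree : List ℕ → Set
MultiplicityFree a =
  ∀ T T' → QKT a T → QKT a T' → wt a T ≡ wt a T' → SameTableau T T'

nonzeroParts : List ℕ → ℕ
nonzeroParts a = length (flat a)

-- Write a = (0, α₁, 0, …, 0, α₂, 0, …) with α₂ in position p ≥ 3. A tableau in
-- QKT(a) is determined by the rows of its 2s (rows 1 and 2, weakly descending
-- along columns 1..α₁) and of its p's (weakly descending along columns 1..α₂).
-- Rows ≥ 3 of the weight count p's only, so they fix how many p's lie in each
-- row r ≥ 3; what is left is how row 2 is shared between 2s and p's. If two
-- tableaux of equal weight shared it differently, the one with more 2s there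
-- would have its last p in row 1. When α₂ ≤ α₁ that p sits under a 2, and rule
-- (iv) forces more than α₂ 2s into row 2, which has at most α₂ cells (as the
-- other tableau shows); when α₁ ≤ 2 < α₂ the quasi-Yamanouchi condition for
-- row 1 fails. If 3 ≤ α₁ < α₂, two staircase tableaux, differing by a 2 moved
-- down and a p moved up, have equal weight. The partition conditions of the
-- statement say exactly that α₂ ≤ α₁ or α₁ ≤ 2.

module Submission where

open import Defs
open import Data.Nat
open import Data.Nat.Properties
open import Data.Bool using (Bool; true; false; T; T?; not; _∧_)
open import Data.Bool.Properties using (∧-identityʳ; ∧-zeroʳ)
open import Data.List using (List; []; _∷_; length; map; filterᵇ; _++_)
open import Data.List.Properties using (∷-injective; map-++; map-∘; map-cong; filter-++; length-++)
open import Data.List.Membership.Propositional using (_∈_)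
open import Data.List.Membership.Propositional.Properties using (∈-map⁺; ∈-map⁻; ∈-++⁺ˡ; ∈-++⁺ʳ; ∈-++⁻; ∈-upTo⁺)
open import Data.List.Relation.Unary.Any using (here; there)
import Data.List.Relation.Unary.All as All
open import Data.List.Relation.Unary.AllPairs using ([]; _∷_)
open import Data.List.Relation.Unary.Unique.Propositional using (Unique)
import Data.List.Relation.Unary.Unique.Propositional.Properties as Unique
open import Data.Product using (_×_; _,_; Σ; ∃-syntax; proj₁; proj₂)
open import Data.Sum using (_⊎_; inj₁; inj₂)
open import Data.Empty using (⊥; ⊥-elim)
open import Relation.Nullary using (¬_; yes; no)
open import Relation.Binary.Definitions using (tri<; tri≈; tri>)
open import Relation.Binary.PropositionalEquality
open import Function.Bundles using (_⇔_; mk⇔; Equivalence)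
open import Function.Properties.Equivalence using () renaming (trans to ⇔-trans; sym to ⇔-sym)
open import Algebra.Properties.CommutativeSemigroup +-commutativeSemigroup using (interchange; xy∙z≈zy∙x)

open Equivalence using (to; from)

⟦_⟧ : Bool → ℕ
⟦ true ⟧  = 1
⟦ false ⟧ = 0

false≢true : false ≢ true
false≢true ()

⟦⟧≤1 : ∀ b → ⟦ b ⟧ ≤ 1
⟦⟧≤1 true  = ≤-refl
⟦⟧≤1 false = z≤n

≡ᵇ-true⇒≡ : ∀ {m n} → (m ≡ᵇ n) ≡ true → m ≡ n
≡ᵇ-true⇒≡ {m} {n} e = ≡ᵇ⇒≡ m n (subst T (sym e) _)

≡⇒≡ᵇ-true : ∀ {m n} → m ≡ n → (m ≡ᵇ n) ≡ true
≡⇒≡ᵇ-true {zero}  refl = refl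
≡⇒≡ᵇ-true {suc m} refl = ≡⇒≡ᵇ-true {m} refl

≢⇒≡ᵇ-false : ∀ {m n} → m ≢ n → (m ≡ᵇ n) ≡ false
≢⇒≡ᵇ-false {m} {n} m≢n with m ≡ᵇ n in eq
... | true  = ⊥-elim (m≢n (≡ᵇ-true⇒≡ eq))
... | false = refl

≤ᵇ-true⇒≤ : ∀ {m n} → (m ≤ᵇ n) ≡ true → m ≤ n
≤ᵇ-true⇒≤ {m} {n} e = ≤ᵇ⇒≤ m n (subst T (sym e) _)

≤⇒≤ᵇ-true : ∀ {m n} → m ≤ n → (m ≤ᵇ n) ≡ true
≤⇒≤ᵇ-true {m} {n} m≤n with m ≤ᵇ n | ≤⇒≤ᵇ m≤n
... | true | _ = refl

>⇒≤ᵇ-false : ∀ {m n} → n < m → (m ≤ᵇ n) ≡ false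
>⇒≤ᵇ-false {m} {n} n<m with m ≤ᵇ n in eq
... | true  = ⊥-elim (<⇒≱ n<m (≤ᵇ-true⇒≤ eq))
... | false = refl

count : {A : Set} → (A → Bool) → List A → ℕ
count P xs = length (filterᵇ P xs)

module _ {A : Set} where

  count-∷ : ∀ (P : A → Bool) x xs → count P (x ∷ xs) ≡ ⟦ P x ⟧ + count P xs
  count-∷ P x xs with P x
  ... | true  = refl
  ... | false = refl

  count-++ : ∀ (P : A → Bool) xs ys → count P (xs ++ ys) ≡ count P xs + count P ys
  count-++ P xs ys = trans (cong length (filter-++ (λ x → T? (P x)) xs ys)) (length-++ (filterᵇ P xs))

  count-+ : ∀ (P Q R : A → Bool) xs → (∀ {x} → x ∈ xs → ⟦ P x ⟧ ≡ ⟦ Q x ⟧ + ⟦ R x ⟧) →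
            count P xs ≡ count Q xs + count R xs
  count-+ P Q R []       _ = refl
  count-+ P Q R (x ∷ xs) h = begin
    count P (x ∷ xs)                                     ≡⟨ count-∷ P x xs ⟩
    ⟦ P x ⟧ + count P xs                                  ≡⟨ cong₂ _+_ (h (here refl)) (count-+ P Q R xs (λ m → h (there m))) ⟩
    (⟦ Q x ⟧ + ⟦ R x ⟧) + (count Q xs + count R xs)        ≡⟨ interchange ⟦ Q x ⟧ _ _ _ ⟩
    (⟦ Q x ⟧ + count Q xs) + (⟦ R x ⟧ + count R xs)        ≡⟨ cong₂ _+_ (count-∷ Q x xs) (count-∷ R x xs) ⟨
    count Q (x ∷ xs) + count R (x ∷ xs)                  ∎
    where open ≡-Reasoning

  count-cong : ∀ (P Q : A → Bool) xs → (∀ {x} → x ∈ xs → P x ≡ Q x) → count P xs ≡ count Q xs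
  count-cong P Q []       _ = refl
  count-cong P Q (x ∷ xs) h = begin
    count P (x ∷ xs)      ≡⟨ count-∷ P x xs ⟩
    ⟦ P x ⟧ + count P xs  ≡⟨ cong₂ _+_ (cong ⟦_⟧ (h (here refl))) (count-cong P Q xs (λ m → h (there m))) ⟩
    ⟦ Q x ⟧ + count Q xs  ≡⟨ count-∷ Q x xs ⟨
    count Q (x ∷ xs)      ∎
    where open ≡-Reasoning

  count-none : ∀ (P : A → Bool) xs → (∀ {x} → x ∈ xs → P x ≡ false) → count P xs ≡ 0
  count-none P []       _ = refl
  count-none P (x ∷ xs) h rewrite count-∷ P x xs | h (here refl) = count-none P xs (λ m → h (there m))

  count-pos : ∀ (P : A → Bool) xs {x} → x ∈ xs → P x ≡ true → 1 ≤ count P xs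
  count-pos P (y ∷ xs) (here refl) e rewrite count-∷ P y xs | e = s≤s z≤n
  count-pos P (y ∷ xs) (there m)   e rewrite count-∷ P y xs = ≤-trans (count-pos P xs m e) (m≤n+m _ ⟦ P y ⟧)

  count≡0⇒false : ∀ (P : A → Bool) xs {x} → count P xs ≡ 0 → x ∈ xs → P x ≡ false
  count≡0⇒false P xs {x} c≡0 m with P x in eq
  ... | false = refl
  ... | true  = ⊥-elim (1+n≰n (subst (1 ≤_) c≡0 (count-pos P xs m eq)))

  count≡1⇒unique : ∀ (P : A → Bool) xs → count P xs ≡ 1 →
    Σ A λ x → x ∈ xs × P x ≡ true × (∀ {y} → y ∈ xs → P y ≡ true → y ≡ x)
  count≡1⇒unique P (x ∷ xs) c≡1 with P x in eq
  ... | true  = x , here refl , eq , λ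
        { (here refl) _ → refl
        ; (there m) e → ⊥-elim (1+n≰n (subst (1 ≤_) (suc-injective c≡1) (count-pos P xs m e))) }
  ... | false with count≡1⇒unique P xs c≡1
  ... | x₀ , m , e , u = x₀ , there m , e , λ
        { (here refl) e′ → ⊥-elim (false≢true (trans (sym eq) e′))
        ; (there m′) e′ → u m′ e′ }

countCols : (ℕ → Bool) → ℕ → ℕ
countCols B zero    = 0
countCols B (suc m) = ⟦ B (suc m) ⟧ + countCols B m

cols : ℕ → List ℕ
cols zero    = []
cols (suc m) = suc m ∷ cols m

InCols : ℕ → ℕ → Set
InCols m c = 1 ≤ c × c ≤ m

private
  inCols-top : ∀ m → InCols (suc m) (suc m)
  inCols-top m = s≤s z≤n , ≤-refl

  inCols-weaken : ∀ {m c} → InCols m c → InCols (suc m) c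
  inCols-weaken (1≤c , c≤m) = 1≤c , m≤n⇒m≤1+n c≤m

  inCols-split : ∀ {m c} → InCols (suc m) c → c ≡ suc m ⊎ InCols m c
  inCols-split (1≤c , c≤1+m) with m≤n⇒m<n∨m≡n c≤1+m
  ... | inj₁ c<1+m = inj₂ (1≤c , ≤-pred c<1+m)
  ... | inj₂ c≡1+m = inj₁ c≡1+m

  inCols-zero : ∀ {c} → ¬ InCols 0 c
  inCols-zero (1≤c , c≤0) = 1+n≰n (≤-trans 1≤c c≤0)

count-map-cols : ∀ {A : Set} (P : A → Bool) (f : ℕ → A) m → count P (map f (cols m)) ≡ countCols (λ c → P (f c)) m
count-map-cols P f zero    = refl
count-map-cols P f (suc m) = trans (count-∷ P (f (suc m)) _) (cong (⟦ P (f (suc m)) ⟧ +_) (count-map-cols P f m))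

∈-cols⁻ : ∀ m {c} → c ∈ cols m → InCols m c
∈-cols⁻ (suc m) (here refl) = inCols-top m
∈-cols⁻ (suc m) (there c∈) = inCols-weaken (∈-cols⁻ m c∈)

∈-cols⁺ : ∀ m {c} → InCols m c → c ∈ cols m
∈-cols⁺ zero    c∈ = ⊥-elim (inCols-zero c∈)
∈-cols⁺ (suc m) c∈ with inCols-split c∈
... | inj₁ refl = here refl
... | inj₂ c∈′ = there (∈-cols⁺ m c∈′)

cols-unique : ∀ m → Unique (cols m)
cols-unique zero    = []
cols-unique (suc m) = All.tabulate (λ c∈ 1+m≡c → 1+n≰n (subst (_≤ m) (sym 1+m≡c) (proj₂ (∈-cols⁻ m c∈)))) ∷ cols-unique m

module _ (B : ℕ → Bool) where

  countCols-≤ : ∀ m → countCols B m ≤ m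
  countCols-≤ zero    = z≤n
  countCols-≤ (suc m) = +-mono-≤ (⟦⟧≤1 (B (suc m))) (countCols-≤ m)

  countCols-none : ∀ m → (∀ {c} → InCols m c → B c ≡ false) → countCols B m ≡ 0
  countCols-none zero    _ = refl
  countCols-none (suc m) h rewrite h (inCols-top m) = countCols-none m (λ c∈ → h (inCols-weaken c∈))

  countCols-all : ∀ m → (∀ {c} → InCols m c → B c ≡ true) → countCols B m ≡ m
  countCols-all zero    _ = refl
  countCols-all (suc m) h rewrite h (inCols-top m) = cong suc (countCols-all m (λ c∈ → h (inCols-weaken c∈)))

  countCols-pos : ∀ m {c} → InCols m c → B c ≡ true → 1 ≤ countCols B m
  countCols-pos zero    c∈ _ = ⊥-elim (inCols-zero c∈)
  countCols-pos (suc m) c∈ e with inCols-split c∈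
  ... | inj₁ refl rewrite e = s≤s z≤n
  ... | inj₂ c∈′ = ≤-trans (countCols-pos m c∈′ e) (m≤n+m _ ⟦ B (suc m) ⟧)

  countCols-witness : ∀ m → 1 ≤ countCols B m → Σ ℕ λ c → InCols m c × B c ≡ true
  countCols-witness (suc m) h with B (suc m) in eq
  ... | true  = suc m , inCols-top m , eq
  ... | false with countCols-witness m h
  ...   | c , c∈ , e = c , inCols-weaken c∈ , e

  countCols-downClosed : ∀ m → (∀ {c c′} → 1 ≤ c → c ≤ c′ → c′ ≤ m → B c′ ≡ true → B c ≡ true) →
    ∀ {c} → InCols m c → (B c ≡ true) ⇔ (c ≤ countCols B m)
  countCols-downClosed zero    _     c∈ = ⊥-elim (inCols-zero c∈)
  countCols-downClosed (suc m) down {c} c∈@(1≤c , c≤1+m) with B (suc m) in eq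
  ... | true  = mk⇔ (λ _ → subst (c ≤_) (cong suc (sym all)) c≤1+m) (λ _ → down 1≤c c≤1+m ≤-refl eq)
    where
    all : countCols B m ≡ m
    all = countCols-all m (λ (1≤c′ , c′≤m) → down 1≤c′ (m≤n⇒m≤1+n c′≤m) ≤-refl eq)
  ... | false with inCols-split c∈
  ...   | inj₂ c∈′ = countCols-downClosed m (λ 1≤c c≤c′ c′≤m → down 1≤c c≤c′ (m≤n⇒m≤1+n c′≤m)) c∈′
  ...   | inj₁ refl = mk⇔ (λ e → ⊥-elim (false≢true (trans (sym eq) e)))
                          (λ 1+m≤ → ⊥-elim (1+n≰n (≤-trans 1+m≤ (countCols-≤ m))))

module _ (B B′ : ℕ → Bool) where

  countCols-cong : ∀ m → (∀ {c} → InCols m c → B c ≡ B′ c) → countCols B m ≡ countCols B′ m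
  countCols-cong zero    _ = refl
  countCols-cong (suc m) h = cong₂ _+_ (cong ⟦_⟧ (h (inCols-top m))) (countCols-cong m (λ c∈ → h (inCols-weaken c∈)))

  countCols-+ : ∀ (B″ : ℕ → Bool) m → (∀ {c} → InCols m c → ⟦ B c ⟧ ≡ ⟦ B′ c ⟧ + ⟦ B″ c ⟧) →
    countCols B m ≡ countCols B′ m + countCols B″ m
  countCols-+ B″ zero    _ = refl
  countCols-+ B″ (suc m) h =
    trans (cong₂ _+_ (h (inCols-top m)) (countCols-+ B″ m (λ c∈ → h (inCols-weaken c∈))))
          (interchange ⟦ B′ (suc m) ⟧ _ _ _)

  countCols-swap : ∀ m {j} → InCols m j → (∀ c → c ≢ j → B c ≡ B′ c) →
    countCols B m + ⟦ B′ j ⟧ ≡ countCols B′ m + ⟦ B j ⟧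
  countCols-swap zero    j∈ _     = ⊥-elim (inCols-zero j∈)
  countCols-swap (suc m) j∈ agree with inCols-split j∈
  ... | inj₁ refl rewrite countCols-cong m (λ (_ , c≤m) → agree _ (λ c≡ → 1+n≰n (subst (_≤ m) c≡ c≤m))) =
    xy∙z≈zy∙x ⟦ B (suc m) ⟧ _ _
  ... | inj₂ j∈′@(_ , j≤m) rewrite agree (suc m) (λ 1+m≡j → 1+n≰n (subst (_≤ m) (sym 1+m≡j) j≤m)) = begin
    ⟦ b ⟧ + countCols B m + ⟦ B′ _ ⟧     ≡⟨ +-assoc ⟦ b ⟧ _ _ ⟩
    ⟦ b ⟧ + (countCols B m + ⟦ B′ _ ⟧)   ≡⟨ cong (⟦ b ⟧ +_) (countCols-swap m j∈′ agree) ⟩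
    ⟦ b ⟧ + (countCols B′ m + ⟦ B _ ⟧)   ≡⟨ +-assoc ⟦ b ⟧ _ _ ⟨
    ⟦ b ⟧ + countCols B′ m + ⟦ B _ ⟧     ∎
    where
    open ≡-Reasoning
    b : Bool
    b = B′ (suc m)

countCols-point : ∀ m {c} → InCols m c → countCols (λ c′ → c′ ≡ᵇ c) m ≡ 1
countCols-point zero    c∈ = ⊥-elim (inCols-zero c∈)
countCols-point (suc m) {c} c∈ with inCols-split c∈
... | inj₁ refl rewrite ≡⇒≡ᵇ-true {suc m} refl =
  cong suc (countCols-none _ m (λ (_ , c′≤m) → ≢⇒≡ᵇ-false (λ c′≡ → 1+n≰n (subst (_≤ m) c′≡ c′≤m))))
... | inj₂ c∈′@(_ , c≤m) rewrite ≢⇒≡ᵇ-false {suc m} {c} (λ 1+m≡c → 1+n≰n (subst (_≤ m) (sym 1+m≡c) c≤m)) =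
  countCols-point m c∈′

record TwoParts (a : List ℕ) : Set where
  field
    α₁ α₂ p : ℕ
    a₂≡α₁   : a ! 2 ≡ α₁
    aₚ≡α₂   : a ! p ≡ α₂
    1≤α₁    : 1 ≤ α₁
    1≤α₂    : 1 ≤ α₂
    3≤p     : 3 ≤ p
    p≤ℓ     : p ≤ length a
    a-zero  : ∀ i → i ≢ 2 → i ≢ p → a ! i ≡ 0
    flat≡   : flat a ≡ α₁ ∷ α₂ ∷ []

  p≢2 : p ≢ 2
  p≢2 p≡2 = 1+n≰n (subst (3 ≤_) p≡2 3≤p)

  2≤ℓ : 2 ≤ length a
  2≤ℓ = ≤-trans (n≤1+n 2) (≤-trans 3≤p p≤ℓ)

private
  noParts : ∀ xs → length (flat xs) ≡ 0 → ∀ i → xs ! i ≡ 0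
  noParts []         _  _             = refl
  noParts (zero ∷ _) _  zero          = refl
  noParts (zero ∷ _) _  (suc zero)    = refl
  noParts (zero ∷ xs) h (suc (suc i)) = noParts xs h (suc i)

  onePart : ∀ xs → length (flat xs) ≡ 1 →
    Σ ℕ λ j → Σ ℕ λ v → xs ! suc j ≡ suc v × suc j ≤ length xs ×
      (∀ i → i ≢ suc j → xs ! i ≡ 0) × flat xs ≡ suc v ∷ []
  onePart (zero ∷ xs) h with onePart xs h
  ... | j , v , xs!j , j<ℓ , others , flat≡ = suc j , v , xs!j , s≤s j<ℓ , others′ , flat≡
    where
    others′ : ∀ i → i ≢ suc (suc j) → (zero ∷ xs) ! i ≡ 0
    others′ zero          _ = refl
    others′ (suc zero)    _ = refl
    others′ (suc (suc i)) i≢ = others (suc i) (λ e → i≢ (cong suc e))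
  onePart (suc x ∷ xs) h =
    0 , x , refl , s≤s z≤n , others , cong (suc x ∷_) (length≡0 (flat xs) (suc-injective h))
    where
    length≡0 : ∀ ys → length ys ≡ 0 → ys ≡ []
    length≡0 [] _ = refl
    others : ∀ i → i ≢ 1 → (suc x ∷ xs) ! i ≡ 0
    others zero          _   = refl
    others (suc zero)    i≢1 = ⊥-elim (i≢1 refl)
    others (suc (suc i)) _   = noParts xs (suc-injective h) (suc i)

twoParts : ∀ a → nonzeroParts a ≡ 2 → a ! 1 ≡ 0 → a ! 2 ≢ 0 → TwoParts a
twoParts (x ∷ [])              _  _  a₂≢0 = ⊥-elim (a₂≢0 refl)
twoParts (x ∷ zero ∷ _)        _  _  a₂≢0 = ⊥-elim (a₂≢0 refl)
twoParts (zero ∷ suc y ∷ rest) h₂ _  _ with onePart rest (suc-injective h₂)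
... | j , v , rest!j , j<ℓ , others , flat≡ = record
  { α₁ = suc y ; α₂ = suc v ; p = 3 + j
  ; a₂≡α₁ = refl ; aₚ≡α₂ = rest!j ; 1≤α₁ = s≤s z≤n ; 1≤α₂ = s≤s z≤n
  ; 3≤p = s≤s (s≤s (s≤s z≤n)) ; p≤ℓ = s≤s (s≤s j<ℓ)
  ; a-zero = a-zero ; flat≡ = cong (suc y ∷_) flat≡ }
  where
  a-zero : ∀ i → i ≢ 2 → i ≢ 3 + j → (zero ∷ suc y ∷ rest) ! i ≡ 0
  a-zero zero                _   _ = refl
  a-zero (suc zero)          _   _ = refl
  a-zero (suc (suc zero))    i≢2 _ = ⊥-elim (i≢2 refl)
  a-zero (suc (suc (suc i))) _ i≢p = others (suc i) (λ e → i≢p (cong (λ k → suc (suc k)) e))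

≤ᵇ-suc : ∀ m n → (suc m ≤ᵇ suc n) ≡ (m ≤ᵇ n)
≤ᵇ-suc zero    n = refl
≤ᵇ-suc (suc m) n = refl

⟦≤ᵇ⟧-split : ∀ r x → ⟦ r ≤ᵇ x ⟧ ≡ ⟦ x ≡ᵇ r ⟧ + ⟦ suc r ≤ᵇ x ⟧
⟦≤ᵇ⟧-split zero    zero    = refl
⟦≤ᵇ⟧-split zero    (suc x) = refl
⟦≤ᵇ⟧-split (suc r) zero    = refl
⟦≤ᵇ⟧-split (suc r) (suc x) rewrite ≤ᵇ-suc r x | ≤ᵇ-suc (suc r) x = ⟦≤ᵇ⟧-split r x

oneOrTwo-≡ : ∀ {x y} → 1 ≤ x × x ≤ 2 → 1 ≤ y × y ≤ 2 → (x ≡ 2 ⇔ y ≡ 2) → x ≡ y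
oneOrTwo-≡ {1} {1} _ _ _ = refl
oneOrTwo-≡ {1} {2} _ _ x≡2⇔y≡2 = from x≡2⇔y≡2 refl
oneOrTwo-≡ {2} {1} _ _ x≡2⇔y≡2 = sym (to x≡2⇔y≡2 refl)
oneOrTwo-≡ {2} {2} _ _ _ = refl
oneOrTwo-≡ {suc (suc (suc _))} (_ , s≤s (s≤s ())) _
oneOrTwo-≡ {_} {suc (suc (suc _))} _ (_ , s≤s (s≤s ()))

oneOrTwo-≢1 : ∀ {x} → 1 ≤ x × x ≤ 2 → x ≢ 1 → x ≡ 2
oneOrTwo-≢1 {1} _ x≢1 = ⊥-elim (x≢1 refl)
oneOrTwo-≢1 {2} _ _ = refl
oneOrTwo-≢1 {suc (suc (suc _))} (_ , s≤s (s≤s ()))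

≤-fromThresholds : ∀ {x y} → 1 ≤ y → (∀ r → 2 ≤ r → r ≤ x → r ≤ y) → x ≤ y
≤-fromThresholds {0}                 _   _ = z≤n
≤-fromThresholds {1}                 1≤y _ = 1≤y
≤-fromThresholds {x@(suc (suc _))} _   h = h x (s≤s (s≤s z≤n)) ≤-refl

AntitoneOn : ℕ → (ℕ → ℕ) → Set
AntitoneOn m R = ∀ {c c′} → 1 ≤ c → c ≤ c′ → c′ ≤ m → R c′ ≤ R c

-- A tableau in QKT(a) is encoded by the rows row₂ c and rowₚ c of its cells
-- with entries 2 and p in column c; the fields are the consequences of (i)-(v)
-- that the uniqueness argument uses.
module RowDataTheory (α₁ α₂ ℓ : ℕ) where

  InRow : (ℕ → ℕ) → (ℕ → ℕ) → ℕ → ℕ → Set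
  InRow row₂ rowₚ r c = (InCols α₁ c × row₂ c ≡ r) ⊎ (InCols α₂ c × rowₚ c ≡ r)

  record RowData : Set where
    field
      row₂ rowₚ     : ℕ → ℕ
      row₂-range    : ∀ {c} → InCols α₁ c → 1 ≤ row₂ c × row₂ c ≤ 2
      rowₚ-range    : ∀ {c} → InCols α₂ c → 1 ≤ rowₚ c × rowₚ c ≤ ℓ
      row₂-antitone : AntitoneOn α₁ row₂
      rowₚ-antitone : AntitoneOn α₂ rowₚ
      row₂≢rowₚ     : ∀ {c} → InCols α₁ c → c ≤ α₂ → row₂ c ≢ rowₚ c
      kohnert       : ∀ {c} → InCols α₁ c → c ≤ α₂ → row₂ c ≡ 2 → rowₚ c ≡ 1 →
                      suc c ≤ α₁ × row₂ (suc c) ≡ 2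
      yamanouchi₂   : ∀ {c} → InCols α₂ c → rowₚ c ≡ 2 → Σ ℕ λ c₂ → InCols α₁ c₂ × row₂ c₂ ≡ 2
      yamanouchi₁   : ∀ {c} → InCols α₂ c → rowₚ c ≡ 1 →
                      Σ ℕ λ c₁ → Σ ℕ λ c₂ → c₁ ≤ c₂ × InRow row₂ rowₚ 1 c₁ × InRow row₂ rowₚ 2 c₂

  module _ (D : RowData) where
    open RowData D

    weight : ℕ → ℕ
    weight r = countCols (λ c → row₂ c ≡ᵇ r) α₁ + countCols (λ c → rowₚ c ≡ᵇ r) α₂

    twos : ℕ
    twos = countCols (λ c → row₂ c ≡ᵇ 2) α₁

    pInRow : ℕ → ℕ
    pInRow r = countCols (λ c → rowₚ c ≡ᵇ r) α₂

    pAtLeast : ℕ → ℕ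
    pAtLeast r = countCols (λ c → r ≤ᵇ rowₚ c) α₂

    row₂≡2⇔≤twos : ∀ {c} → InCols α₁ c → (row₂ c ≡ 2) ⇔ (c ≤ twos)
    row₂≡2⇔≤twos {c} c∈ = mk⇔ (λ e → to eqv (≡⇒≡ᵇ-true e)) (λ le → ≡ᵇ-true⇒≡ (from eqv le))
      where
      down : ∀ {c c′} → 1 ≤ c → c ≤ c′ → c′ ≤ α₁ → (row₂ c′ ≡ᵇ 2) ≡ true → (row₂ c ≡ᵇ 2) ≡ true
      down 1≤c c≤c′ c′≤α₁ e = ≡⇒≡ᵇ-true (≤-antisym (proj₂ (row₂-range (1≤c , ≤-trans c≤c′ c′≤α₁)))
                                (subst (_≤ row₂ _) (≡ᵇ-true⇒≡ e) (row₂-antitone 1≤c c≤c′ c′≤α₁)))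
      eqv : ((row₂ c ≡ᵇ 2) ≡ true) ⇔ (c ≤ twos)
      eqv = countCols-downClosed _ α₁ down c∈

    ≤rowₚ⇔≤pAtLeast : ∀ r {c} → InCols α₂ c → (r ≤ rowₚ c) ⇔ (c ≤ pAtLeast r)
    ≤rowₚ⇔≤pAtLeast r {c} c∈ = mk⇔ (λ le → to eqv (≤⇒≤ᵇ-true le)) (λ le → ≤ᵇ-true⇒≤ {r} (from eqv le))
      where
      down : ∀ {c c′} → 1 ≤ c → c ≤ c′ → c′ ≤ α₂ → (r ≤ᵇ rowₚ c′) ≡ true → (r ≤ᵇ rowₚ c) ≡ true
      down 1≤c c≤c′ c′≤α₂ e = ≤⇒≤ᵇ-true (≤-trans (≤ᵇ-true⇒≤ {r} e) (rowₚ-antitone 1≤c c≤c′ c′≤α₂))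
      eqv : ((r ≤ᵇ rowₚ c) ≡ true) ⇔ (c ≤ pAtLeast r)
      eqv = countCols-downClosed _ α₂ down c∈

    pAtLeast-suc : ∀ r → pAtLeast r ≡ pInRow r + pAtLeast (suc r)
    pAtLeast-suc r = countCols-+ _ _ _ α₂ (λ {c} _ → ⟦≤ᵇ⟧-split r (rowₚ c))

    pAtLeast-beyond : ∀ r → ℓ < r → pAtLeast r ≡ 0
    pAtLeast-beyond r ℓ<r = countCols-none _ α₂ (λ c∈ → >⇒≤ᵇ-false (<-≤-trans (s≤s (proj₂ (rowₚ-range c∈))) ℓ<r))

    weight-above2 : ∀ r → 3 ≤ r → weight r ≡ pInRow r
    weight-above2 r 3≤r = cong (_+ pInRow r)
      (countCols-none _ α₁ (λ c∈ → ≢⇒≡ᵇ-false (λ e → <⇒≱ (subst (2 <_) (sym e) 3≤r) (proj₂ (row₂-range c∈)))))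

    twos-pos : 1 ≤ pInRow 2 → 1 ≤ twos
    twos-pos 1≤pInRow2 with countCols-witness _ α₂ 1≤pInRow2
    ... | c , c∈ , e with yamanouchi₂ c∈ (≡ᵇ-true⇒≡ e)
    ...   | c₂ , c₂∈ , e₂ = countCols-pos _ α₁ c₂∈ (≡⇒≡ᵇ-true e₂)

    pInRow2-column : 1 ≤ pInRow 2 → let K = pAtLeast 3 in InCols α₂ (suc K) × rowₚ (suc K) ≡ 2
    pInRow2-column 1≤pInRow2 = K+1∈ , rowₚ≡2
      where
      K : ℕ
      K = pAtLeast 3
      K<pAtLeast2 : suc K ≤ pAtLeast 2
      K<pAtLeast2 = subst (suc K ≤_) (sym (pAtLeast-suc 2)) (+-monoˡ-≤ K 1≤pInRow2)
      K+1∈ : InCols α₂ (suc K)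
      K+1∈ = s≤s z≤n , ≤-trans K<pAtLeast2 (countCols-≤ _ α₂)
      rowₚ≡2 : rowₚ (suc K) ≡ 2
      rowₚ≡2 with 3 ≤? rowₚ (suc K)
      ... | yes 3≤ = ⊥-elim (1+n≰n (to (≤rowₚ⇔≤pAtLeast 3 K+1∈) 3≤))
      ... | no  3≰ = ≤-antisym (≤-pred (≰⇒> 3≰)) (from (≤rowₚ⇔≤pAtLeast 2 K+1∈) K<pAtLeast2)

    -- Column pAtLeast 3 + 1 has its p in row 2, so its 2 (if any) is in row 1.
    twos≤pAtLeast3 : 1 ≤ pInRow 2 → twos ≤ pAtLeast 3
    twos≤pAtLeast3 1≤pInRow2 with suc (pAtLeast 3) ≤? α₁ | pInRow2-column 1≤pInRow2
    ... | no  K≥α₁ | _ = ≤-trans (countCols-≤ _ α₁) (≤-pred (≰⇒> K≥α₁))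
    ... | yes K<α₁ | (_ , K<α₂) , rowₚ≡2 with twos ≤? pAtLeast 3
    ...   | yes twos≤K = twos≤K
    ...   | no  twos>K = ⊥-elim (row₂≢rowₚ K+1∈ K<α₂ (trans (from (row₂≡2⇔≤twos K+1∈) (≰⇒> twos>K)) (sym rowₚ≡2)))
      where K+1∈ = s≤s z≤n , K<α₁

    weight2≤α₂ : 1 ≤ pInRow 2 → twos + pInRow 2 ≤ α₂
    weight2≤α₂ 1≤pInRow2 = begin
      twos + pInRow 2          ≤⟨ +-monoˡ-≤ (pInRow 2) (twos≤pAtLeast3 1≤pInRow2) ⟩
      pAtLeast 3 + pInRow 2    ≡⟨ +-comm (pAtLeast 3) _ ⟩
      pInRow 2 + pAtLeast 3    ≡⟨ pAtLeast-suc 2 ⟨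
      pAtLeast 2               ≤⟨ countCols-≤ _ α₂ ⟩
      α₂                       ∎
      where open ≤-Reasoning

    rowₚ-last≡1 : 1 ≤ α₂ → pAtLeast 2 < α₂ → rowₚ α₂ ≡ 1
    rowₚ-last≡1 1≤α₂ pAtLeast2<α₂ with rowₚ α₂ in eq | proj₁ (rowₚ-range (1≤α₂ , ≤-refl))
    ... | 1 | _ = refl
    ... | suc (suc _) | _ =
      ⊥-elim (<⇒≱ pAtLeast2<α₂ (to (≤rowₚ⇔≤pAtLeast 2 (1≤α₂ , ≤-refl)) (subst (2 ≤_) (sym eq) (s≤s (s≤s z≤n)))))

    -- Rule (iv) pushes the 2 of column α₂, sitting above the p, one column further.
    α₂<twos : 1 ≤ α₂ → α₂ ≤ α₁ → rowₚ α₂ ≡ 1 → α₂ < twos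
    α₂<twos 1≤α₂ α₂≤α₁ rowₚ≡1 = to (row₂≡2⇔≤twos (s≤s z≤n , proj₁ next)) (proj₂ next)
      where
      α₂∈ : InCols α₁ α₂
      α₂∈ = 1≤α₂ , α₂≤α₁
      row₂≡2 : row₂ α₂ ≡ 2
      row₂≡2 = oneOrTwo-≢1 (row₂-range α₂∈) (λ row₂≡1 → row₂≢rowₚ α₂∈ ≤-refl (trans row₂≡1 (sym rowₚ≡1)))
      next : suc α₂ ≤ α₁ × row₂ (suc α₂) ≡ 2
      next = kohnert α₂∈ ≤-refl row₂≡2 rowₚ≡1

    -- Rule (v) for row 1 needs a row-2 cell weakly right of a row-1 p: a p would
    -- break antitonicity, and a 2 would put the p of column 2 in row 1 under it,
    -- which (iv) forbids since α₁ = 2.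
    rowₚ-last≢1 : α₁ ≡ 2 → 2 ≤ twos → 3 ≤ α₂ → rowₚ α₂ ≢ 1
    rowₚ-last≢1 refl 2≤twos 3≤α₂ rowₚ≡1 with yamanouchi₁ (≤-trans (s≤s z≤n) 3≤α₂ , ≤-refl) rowₚ≡1
    ... | c₁ , c₂ , c₁≤c₂ , inj₁ (c₁∈ , row₂≡1) , _ =
      1+n≰n (subst (2 ≤_) row₂≡1 (≤-reflexive (sym (from (row₂≡2⇔≤twos c₁∈) (≤-trans (proj₂ c₁∈) 2≤twos)))))
    ... | c₁ , c₂ , c₁≤c₂ , inj₂ ((1≤c₁ , _) , rowₚ₁≡1) , inj₂ ((_ , c₂≤α₂) , rowₚ₂≡2) =
      1+n≰n (subst₂ _≤_ rowₚ₂≡2 rowₚ₁≡1 (rowₚ-antitone 1≤c₁ c₁≤c₂ c₂≤α₂))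
    ... | c₁ , c₂ , c₁≤c₂ , inj₂ ((1≤c₁ , _) , rowₚ₁≡1) , inj₁ ((_ , c₂≤2) , _) =
      1+n≰n (proj₁ (kohnert 2∈ 2≤α₂ row₂≡2 rowₚ≡1′))
      where
      2∈ : InCols 2 2
      2∈ = s≤s z≤n , ≤-refl
      2≤α₂ : 2 ≤ α₂
      2≤α₂ = ≤-trans (n≤1+n 2) 3≤α₂
      row₂≡2 : row₂ 2 ≡ 2
      row₂≡2 = from (row₂≡2⇔≤twos 2∈) 2≤twos
      rowₚ≡1′ : rowₚ 2 ≡ 1
      rowₚ≡1′ = ≤-antisym (subst (rowₚ 2 ≤_) rowₚ₁≡1 (rowₚ-antitone 1≤c₁ (≤-trans c₁≤c₂ c₂≤2) 2≤α₂))
                          (proj₁ (rowₚ-range (s≤s z≤n , 2≤α₂)))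

  module Comparison (D D′ : RowData) (same-weight : ∀ r → 1 ≤ r → r ≤ ℓ → weight D r ≡ weight D′ r) where
    open RowData

    pAtLeast-high : ∀ r → 3 ≤ r → pAtLeast D r ≡ pAtLeast D′ r
    pAtLeast-high r 3≤r = go ℓ r 3≤r (+-monoˡ-≤ ℓ (≤-trans (s≤s z≤n) 3≤r))
      where
      go : ∀ d r → 3 ≤ r → ℓ < r + d → pAtLeast D r ≡ pAtLeast D′ r
      go d r 3≤r ℓ<r+d with ℓ <? r
      ... | yes ℓ<r = trans (pAtLeast-beyond D r ℓ<r) (sym (pAtLeast-beyond D′ r ℓ<r))
      go zero r 3≤r ℓ<r | no ℓ≮r = ⊥-elim (ℓ≮r (subst (ℓ <_) (+-identityʳ r) ℓ<r))
      go (suc d) r 3≤r ℓ<r+d | no ℓ≮r = begin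
        pAtLeast D r                       ≡⟨ pAtLeast-suc D r ⟩
        pInRow D r + pAtLeast D (suc r)    ≡⟨ cong₂ _+_ pInRow≡ (go d (suc r) (m≤n⇒m≤1+n 3≤r) (subst (ℓ <_) (+-suc r d) ℓ<r+d)) ⟩
        pInRow D′ r + pAtLeast D′ (suc r)  ≡⟨ pAtLeast-suc D′ r ⟨
        pAtLeast D′ r                      ∎
        where
        open ≡-Reasoning
        pInRow≡ : pInRow D r ≡ pInRow D′ r
        pInRow≡ = trans (sym (weight-above2 D r 3≤r))
                    (trans (same-weight r (≤-trans (s≤s z≤n) 3≤r) (≮⇒≥ ℓ≮r)) (weight-above2 D′ r 3≤r))

    -- With fewer 2s in row 2, D has more p's there than D′; as they agree above
    -- row 2, D′ has fewer than α₂ p's in rows ≥ 2, so its last p lies in row 1.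
    module _ (1≤α₂ : 1 ≤ α₂) (2≤ℓ : 2 ≤ ℓ) (twos< : twos D < twos D′) where
      private
        weight2 : twos D + pInRow D 2 ≡ twos D′ + pInRow D′ 2
        weight2 = same-weight 2 (s≤s z≤n) 2≤ℓ
        pInRow2< : pInRow D′ 2 < pInRow D 2
        pInRow2< = ≰⇒> λ ≤′ → <-irrefl weight2 (+-mono-<-≤ twos< ≤′)
        1≤pInRow2 : 1 ≤ pInRow D 2
        1≤pInRow2 = ≤-trans (s≤s z≤n) pInRow2<
        pAtLeast2′< : pAtLeast D′ 2 < α₂
        pAtLeast2′< = begin-strict
          pAtLeast D′ 2                     ≡⟨ pAtLeast-suc D′ 2 ⟩
          pInRow D′ 2 + pAtLeast D′ 3       <⟨ +-monoˡ-< _ pInRow2< ⟩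
          pInRow D 2 + pAtLeast D′ 3        ≡⟨ cong (pInRow D 2 +_) (pAtLeast-high 3 ≤-refl) ⟨
          pInRow D 2 + pAtLeast D 3         ≡⟨ pAtLeast-suc D 2 ⟨
          pAtLeast D 2                      ≤⟨ countCols-≤ _ α₂ ⟩
          α₂                                ∎
          where open ≤-Reasoning
        rowₚ′≡1 : rowₚ D′ α₂ ≡ 1
        rowₚ′≡1 = rowₚ-last≡1 D′ 1≤α₂ pAtLeast2′<

      twos-≮ : α₂ ≤ α₁ ⊎ α₁ ≤ 2 → ⊥
      twos-≮ shape with α₂ ≤? α₁ | shape
      ... | yes α₂≤α₁ | _ = <⇒≱ (α₂<twos D′ 1≤α₂ α₂≤α₁ rowₚ′≡1) (begin
            twos D′                   ≤⟨ m≤m+n (twos D′) _ ⟩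
            twos D′ + pInRow D′ 2     ≡⟨ weight2 ⟨
            twos D + pInRow D 2       ≤⟨ weight2≤α₂ D 1≤pInRow2 ⟩
            α₂                        ∎)
        where open ≤-Reasoning
      ... | no α₂≰α₁ | inj₁ α₂≤α₁ = α₂≰α₁ α₂≤α₁
      ... | no α₂≰α₁ | inj₂ α₁≤2 = rowₚ-last≢1 D′ α₁≡2 2≤twos′ 3≤α₂ rowₚ′≡1
        where
        2≤twos′ : 2 ≤ twos D′
        2≤twos′ = ≤-trans (s≤s (twos-pos D 1≤pInRow2)) twos<
        α₁≡2 : α₁ ≡ 2
        α₁≡2 = ≤-antisym α₁≤2 (≤-trans 2≤twos′ (countCols-≤ _ α₁))
        3≤α₂ : 3 ≤ α₂
        3≤α₂ = subst (_< α₂) α₁≡2 (≰⇒> α₂≰α₁)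

  module _ (1≤α₂ : 1 ≤ α₂) (2≤ℓ : 2 ≤ ℓ) (shape : α₂ ≤ α₁ ⊎ α₁ ≤ 2) (D D′ : RowData)
           (same-weight : ∀ r → 1 ≤ r → r ≤ ℓ → weight D r ≡ weight D′ r) where
    open RowData

    twos-determined : twos D ≡ twos D′
    twos-determined with <-cmp (twos D) (twos D′)
    ... | tri< lt _ _ = ⊥-elim (Comparison.twos-≮ D D′ same-weight 1≤α₂ 2≤ℓ lt shape)
    ... | tri≈ _ eq _ = eq
    ... | tri> _ _ gt = ⊥-elim (Comparison.twos-≮ D′ D (λ r 1≤r r≤ℓ → sym (same-weight r 1≤r r≤ℓ)) 1≤α₂ 2≤ℓ gt shape)

    pAtLeast-determined : ∀ r → 2 ≤ r → pAtLeast D r ≡ pAtLeast D′ r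
    pAtLeast-determined r 2≤r with m≤n⇒m<n∨m≡n 2≤r
    ... | inj₁ 2<r = Comparison.pAtLeast-high D D′ same-weight r 2<r
    ... | inj₂ refl = begin
      pAtLeast D 2                  ≡⟨ pAtLeast-suc D 2 ⟩
      pInRow D 2 + pAtLeast D 3     ≡⟨ cong₂ _+_ pInRow2≡ (Comparison.pAtLeast-high D D′ same-weight 3 ≤-refl) ⟩
      pInRow D′ 2 + pAtLeast D′ 3   ≡⟨ pAtLeast-suc D′ 2 ⟨
      pAtLeast D′ 2                 ∎
      where
      open ≡-Reasoning
      pInRow2≡ : pInRow D 2 ≡ pInRow D′ 2
      pInRow2≡ = +-cancelˡ-≡ (twos D) _ _
                   (trans (same-weight 2 (s≤s z≤n) 2≤ℓ) (cong (_+ pInRow D′ 2) (sym twos-determined)))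

    row₂-determined : ∀ {c} → InCols α₁ c → row₂ D c ≡ row₂ D′ c
    row₂-determined c∈ = oneOrTwo-≡ (row₂-range D c∈) (row₂-range D′ c∈) (mk⇔
      (λ e → from (row₂≡2⇔≤twos D′ c∈) (subst (_ ≤_) twos-determined (to (row₂≡2⇔≤twos D c∈) e)))
      (λ e → from (row₂≡2⇔≤twos D c∈) (subst (_ ≤_) (sym twos-determined) (to (row₂≡2⇔≤twos D′ c∈) e))))

    rowₚ-determined : ∀ {c} → InCols α₂ c → rowₚ D c ≡ rowₚ D′ c
    rowₚ-determined {c} c∈ = ≤-antisym (≤-fromThresholds (proj₁ (rowₚ-range D′ c∈)) (transport D D′ pAtLeast-determined))
                                   (≤-fromThresholds (proj₁ (rowₚ-range D c∈)) (transport D′ D (λ r 2≤r → sym (pAtLeast-determined r 2≤r))))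
      where
      transport : ∀ E E′ → (∀ r → 2 ≤ r → pAtLeast E r ≡ pAtLeast E′ r) → ∀ r → 2 ≤ r → r ≤ rowₚ E c → r ≤ rowₚ E′ c
      transport E E′ eq r 2≤r r≤ = from (≤rowₚ⇔≤pAtLeast E′ r c∈) (subst (_ ≤_) (eq r 2≤r) (to (≤rowₚ⇔≤pAtLeast E r c∈) r≤))

unique-pos⇒≡ : ∀ {T : Filling} → Unique (map pos T) → ∀ {x y} → x ∈ T → y ∈ T → pos x ≡ pos y → x ≡ y
unique-pos⇒≡ _         (here refl) (here refl) _ = refl
unique-pos⇒≡ (x∉ ∷ _) (here refl) (there y∈) e = ⊥-elim (All.lookup x∉ (∈-map⁺ pos y∈) e)
unique-pos⇒≡ (y∉ ∷ _) (there x∈) (here refl) e = ⊥-elim (All.lookup y∉ (∈-map⁺ pos x∈) (sym e))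
unique-pos⇒≡ (_ ∷ u)  (there x∈) (there y∈) e = unique-pos⇒≡ u x∈ y∈ e

map-≡⇒≡ : ∀ {A B : Set} (f g : A → B) {xs x} → map f xs ≡ map g xs → x ∈ xs → f x ≡ g x
map-≡⇒≡ f g {_ ∷ _} e (here refl) = proj₁ (∷-injective e)
map-≡⇒≡ f g {_ ∷ _} e (there x∈)  = map-≡⇒≡ f g (proj₂ (∷-injective e)) x∈

wt-≡⇒countRow-≡ : ∀ a T T′ → wt a T ≡ wt a T′ → ∀ r → 1 ≤ r → r ≤ length a → countRow r T ≡ countRow r T′
wt-≡⇒countRow-≡ a _ _ e (suc r) _ r<ℓ = map-≡⇒≡ _ _ e (∈-map⁺ suc (∈-upTo⁺ r<ℓ))

headRow : Filling → ℕ
headRow []      = 0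
headRow (x ∷ _) = row x

headRow-filter : ∀ (P : Cell → Bool) T {x₀} → x₀ ∈ T → P x₀ ≡ true →
  (∀ {y} → y ∈ T → P y ≡ true → y ≡ x₀) → headRow (filterᵇ P T) ≡ row x₀
headRow-filter P (y ∷ T) x₀∈ Px₀ only with P y in eq
... | true = cong row (only (here refl) eq)
... | false with x₀∈
...   | here refl = ⊥-elim (false≢true (trans (sym eq) Px₀))
...   | there x₀∈′ = headRow-filter P T x₀∈′ Px₀ (λ y∈ → only (there y∈))

isAt : ℕ → ℕ → Cell → Bool
isAt e c x = (ent x ≡ᵇ e) ∧ (col x ≡ᵇ c)

isAt-true : ∀ {e c x} → ent x ≡ e → col x ≡ c → isAt e c x ≡ true
isAt-true {e} {c} refl refl rewrite ≡⇒≡ᵇ-true {e} refl | ≡⇒≡ᵇ-true {c} refl = refl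

isAt-true⁻ : ∀ e c x → isAt e c x ≡ true → ent x ≡ e × col x ≡ c
isAt-true⁻ e c x h with ent x ≡ᵇ e in e₁ | col x ≡ᵇ c in e₂
... | true | true = ≡ᵇ-true⇒≡ e₁ , ≡ᵇ-true⇒≡ e₂

⟦≤ᵇ-suc⟧-split : ∀ b n m f →
  ⟦ (b ∧ (n ≤ᵇ suc m)) ∧ f ⟧ ≡ ⟦ (b ∧ (n ≤ᵇ m)) ∧ f ⟧ + ⟦ (b ∧ (n ≡ᵇ suc m)) ∧ f ⟧
⟦≤ᵇ-suc⟧-split false n m f = refl
⟦≤ᵇ-suc⟧-split true  n m f with <-cmp n (suc m)
... | tri< n<1+m _ _ rewrite ≤⇒≤ᵇ-true (≤-trans (≤-pred n<1+m) (n≤1+n m)) | ≤⇒≤ᵇ-true (≤-pred n<1+m)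
                           | ≢⇒≡ᵇ-false (<⇒≢ n<1+m) = sym (+-identityʳ _)
... | tri≈ _ refl _ rewrite ≤⇒≤ᵇ-true (≤-refl {suc m}) | >⇒≤ᵇ-false {suc m} {m} ≤-refl
                          | ≡⇒≡ᵇ-true {suc m} refl = refl
... | tri> _ _ n>1+m rewrite >⇒≤ᵇ-false n>1+m | >⇒≤ᵇ-false (<-trans (n<1+n m) n>1+m)
                           | ≢⇒≡ᵇ-false (>⇒≢ n>1+m) = refl

⟦∧-not⟧-split : ∀ b l → ⟦ b ⟧ ≡ ⟦ (b ∧ l) ∧ true ⟧ + ⟦ b ∧ not l ⟧
⟦∧-not⟧-split true  true  = refl
⟦∧-not⟧-split true  false = refl
⟦∧-not⟧-split false _     = refl

module FromTableau {a : List ℕ} (A : TwoParts a) {T : Filling} (Q : QKT a T) where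
  open TwoParts A

  ℓ : ℕ
  ℓ = length a

  private
    KT : IsKohnertTableau a T
    KT = proj₁ Q

  distinct-positions : Unique (map pos T)
  distinct-positions = proj₁ (proj₁ KT)

  positive : ∀ {x} → x ∈ T → 1 ≤ row x × 1 ≤ col x × 1 ≤ ent x
  positive = proj₂ (proj₁ KT)

  ent≤ℓ : ∀ {x} → x ∈ T → ent x ≤ ℓ
  ent≤ℓ = proj₁ (proj₂ KT)

  content : ∀ i → 1 ≤ i → i ≤ ℓ → countEnt i T ≡ a ! i
  content = proj₁ (proj₂ (proj₂ KT))

  oneInColumn : ∀ i → 1 ≤ i → i ≤ ℓ → ∀ c → 1 ≤ c → c ≤ a ! i → countEntCol i c T ≡ 1
  oneInColumn = proj₁ (proj₂ (proj₂ (proj₂ KT)))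

  row≤ent : ∀ {x} → x ∈ T → row x ≤ ent x
  row≤ent = proj₁ (proj₂ (proj₂ (proj₂ (proj₂ KT))))

  descend : ∀ {x y} → x ∈ T → y ∈ T → ent x ≡ ent y → col x < col y → row y ≤ row x
  descend = proj₁ (proj₂ (proj₂ (proj₂ (proj₂ (proj₂ KT)))))

  ruleIV : ∀ {x y} → x ∈ T → y ∈ T → ent x < ent y → col x ≡ col y → row y < row x →
           ∃[ z ] (z ∈ T × ent z ≡ ent x × col z ≡ suc (col y) × row y < row z)
  ruleIV = proj₂ (proj₂ (proj₂ (proj₂ (proj₂ (proj₂ KT)))))

  -- Junk value 0 when column c holds no e.
  rowOf : ℕ → ℕ → ℕ
  rowOf e c = headRow (filterᵇ (isAt e c) T)

  module AtColumn {e c} (1≤e : 1 ≤ e) (e≤ℓ : e ≤ ℓ) (c∈ : InCols (a ! e) c) where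
    private
      theCell : Σ Cell λ x → x ∈ T × isAt e c x ≡ true × (∀ {y} → y ∈ T → isAt e c y ≡ true → y ≡ x)
      theCell = count≡1⇒unique (isAt e c) T (oneInColumn e 1≤e e≤ℓ c (proj₁ c∈) (proj₂ c∈))
      x₀ : Cell
      x₀ = proj₁ theCell
      x₀∈ : x₀ ∈ T
      x₀∈ = proj₁ (proj₂ theCell)
      x₀-isAt : isAt e c x₀ ≡ true
      x₀-isAt = proj₁ (proj₂ (proj₂ theCell))
      only-x₀ : ∀ {y} → y ∈ T → isAt e c y ≡ true → y ≡ x₀
      only-x₀ = proj₂ (proj₂ (proj₂ theCell))
      rowOf≡ : rowOf e c ≡ row x₀
      rowOf≡ = headRow-filter (isAt e c) T x₀∈ x₀-isAt only-x₀

    rowOf-∈ : (rowOf e c , c , e) ∈ T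
    rowOf-∈ with x₀ | x₀∈ | x₀-isAt | rowOf≡
    ... | (r₀ , c₀ , e₀) | x₀∈′ | isAt₀ | rowOf≡′ with isAt-true⁻ e c (r₀ , c₀ , e₀) isAt₀
    ...   | refl , refl rewrite rowOf≡′ = x₀∈′

    rowOf-unique : ∀ {y} → y ∈ T → ent y ≡ e → col y ≡ c → row y ≡ rowOf e c
    rowOf-unique {y} y∈ refl refl = trans (cong row (only-x₀ y∈ (isAt-true {x = y} refl refl))) (sym rowOf≡)

    count-rowOf : ∀ (F : ℕ → Bool) → count (λ x → isAt e c x ∧ F (row x)) T ≡ ⟦ F (rowOf e c) ⟧
    count-rowOf F = trans (count-cong _ (λ x → isAt e c x ∧ F (rowOf e c)) T at-rowOf) (constant (F (rowOf e c)) refl)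
      where
      at-rowOf : ∀ {x} → x ∈ T → (isAt e c x ∧ F (row x)) ≡ (isAt e c x ∧ F (rowOf e c))
      at-rowOf {x} x∈ with isAt e c x in eq
      ... | false = refl
      ... | true  = cong F (trans (cong row (only-x₀ x∈ eq)) (sym rowOf≡))
      constant : ∀ b → F (rowOf e c) ≡ b → count (λ x → isAt e c x ∧ F (rowOf e c)) T ≡ ⟦ b ⟧
      constant true  eq rewrite eq = trans (count-cong _ (isAt e c) T (λ {x} _ → ∧-identityʳ (isAt e c x)))
                                           (oneInColumn e 1≤e e≤ℓ c (proj₁ c∈) (proj₂ c∈))
      constant false eq rewrite eq = count-none _ T (λ {x} _ → ∧-zeroʳ (isAt e c x))

  count-upTo : ∀ e (F : ℕ → Bool) m → 1 ≤ e → e ≤ ℓ → m ≤ a ! e →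
    count (λ x → ((ent x ≡ᵇ e) ∧ (col x ≤ᵇ m)) ∧ F (row x)) T ≡ countCols (λ c → F (rowOf e c)) m
  count-upTo e F zero    _   _   _ = count-none _ T no-column
    where
    no-column : ∀ {x} → x ∈ T → ((ent x ≡ᵇ e) ∧ (col x ≤ᵇ 0)) ∧ F (row x) ≡ false
    no-column {x} x∈ rewrite >⇒≤ᵇ-false {col x} {0} (proj₁ (proj₂ (positive x∈))) | ∧-zeroʳ (ent x ≡ᵇ e) = refl
  count-upTo e F (suc m) 1≤e e≤ℓ m<aₑ = begin
    count (λ x → ((ent x ≡ᵇ e) ∧ (col x ≤ᵇ suc m)) ∧ F (row x)) T
      ≡⟨ count-+ _ _ (λ x → isAt e (suc m) x ∧ F (row x)) T (λ {x} _ → ⟦≤ᵇ-suc⟧-split (ent x ≡ᵇ e) (col x) m (F (row x))) ⟩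
    count (λ x → ((ent x ≡ᵇ e) ∧ (col x ≤ᵇ m)) ∧ F (row x)) T + count (λ x → isAt e (suc m) x ∧ F (row x)) T
      ≡⟨ cong₂ _+_ (count-upTo e F m 1≤e e≤ℓ (≤-trans (n≤1+n m) m<aₑ)) (AtColumn.count-rowOf 1≤e e≤ℓ (s≤s z≤n , m<aₑ) F) ⟩
    countCols (λ c → F (rowOf e c)) m + ⟦ F (rowOf e (suc m)) ⟧
      ≡⟨ +-comm (countCols (λ c → F (rowOf e c)) m) _ ⟩
    countCols (λ c → F (rowOf e c)) (suc m) ∎
    where open ≡-Reasoning

  -- The a_e columns 1..a_e already account for all a_e cells of entry e.
  col≤content : ∀ {x} → x ∈ T → col x ≤ a ! ent x
  col≤content {x} x∈ = ≤ᵇ-true⇒≤ (inRange (count≡0⇒false _ T outside≡0 x∈))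
    where
    e : ℕ
    e = ent x
    1≤e : 1 ≤ e
    1≤e = proj₂ (proj₂ (positive x∈))
    isE inRange? : Cell → Bool
    isE y = ent y ≡ᵇ e
    inRange? y = col y ≤ᵇ (a ! e)
    inside≡aₑ : count (λ y → (isE y ∧ inRange? y) ∧ true) T ≡ a ! e
    inside≡aₑ = trans (count-upTo e (λ _ → true) (a ! e) 1≤e (ent≤ℓ x∈) ≤-refl) (countCols-all _ (a ! e) (λ _ → refl))
    outside≡0 : count (λ y → isE y ∧ not (inRange? y)) T ≡ 0
    outside≡0 = +-cancelˡ-≡ (a ! e) _ _ (begin
      a ! e + count (λ y → isE y ∧ not (inRange? y)) T  ≡⟨ cong (_+ count (λ y → isE y ∧ not (inRange? y)) T) inside≡aₑ ⟨
      count (λ y → (isE y ∧ inRange? y) ∧ true) T + count (λ y → isE y ∧ not (inRange? y)) T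
                                                        ≡⟨ count-+ _ _ _ T (λ {y} _ → ⟦∧-not⟧-split (isE y) (inRange? y)) ⟨
      countEnt e T                                      ≡⟨ content e 1≤e (ent≤ℓ x∈) ⟩
      a ! e                                             ≡⟨ +-identityʳ (a ! e) ⟨
      a ! e + 0                                         ∎)
      where open ≡-Reasoning
    inRange : isE x ∧ not (inRange? x) ≡ false → inRange? x ≡ true
    inRange h rewrite ≡⇒≡ᵇ-true {e} refl with inRange? x
    ... | true = refl

  ent≡2⊎p : ∀ {x} → x ∈ T → ent x ≡ 2 ⊎ ent x ≡ p
  ent≡2⊎p {x} x∈ with ent x ≟ 2 | ent x ≟ p
  ... | yes e≡2 | _       = inj₁ e≡2
  ... | no  _   | yes e≡p = inj₂ e≡p
  ... | no  e≢2 | no  e≢p = ⊥-elim (1+n≰n (subst (1 ≤_) no-cells (count-pos _ T x∈ (≡⇒≡ᵇ-true {ent x} refl))))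
    where
    no-cells : countEnt (ent x) T ≡ 0
    no-cells = trans (content (ent x) (proj₂ (proj₂ (positive x∈))) (ent≤ℓ x∈)) (a-zero (ent x) e≢2 e≢p)

  row₂ rowₚ : ℕ → ℕ
  row₂ = rowOf 2
  rowₚ = rowOf p

  cell₂-∈ : ∀ {c} → InCols α₁ c → (row₂ c , c , 2) ∈ T
  cell₂-∈ c∈ = AtColumn.rowOf-∈ (s≤s z≤n) 2≤ℓ (subst (λ m → InCols m _) (sym a₂≡α₁) c∈)

  cellₚ-∈ : ∀ {c} → InCols α₂ c → (rowₚ c , c , p) ∈ T
  cellₚ-∈ c∈ = AtColumn.rowOf-∈ (≤-trans (s≤s z≤n) 3≤p) p≤ℓ (subst (λ m → InCols m _) (sym aₚ≡α₂) c∈)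

  Cell₂ Cellₚ : Cell → Set
  Cell₂ x = ent x ≡ 2 × InCols α₁ (col x) × row x ≡ row₂ (col x)
  Cellₚ x = ent x ≡ p × InCols α₂ (col x) × row x ≡ rowₚ (col x)

  classify : ∀ {x} → x ∈ T → Cell₂ x ⊎ Cellₚ x
  classify {x} x∈ with ent≡2⊎p x∈
  ... | inj₁ refl = inj₁ (refl , c∈ , AtColumn.rowOf-unique (s≤s z≤n) 2≤ℓ c∈′ x∈ refl refl)
    where
    c∈′ : InCols (a ! 2) (col x)
    c∈′ = proj₁ (proj₂ (positive x∈)) , col≤content x∈
    c∈ : InCols α₁ (col x)
    c∈ = subst (λ m → InCols m (col x)) a₂≡α₁ c∈′
  ... | inj₂ refl = inj₂ (refl , c∈ , AtColumn.rowOf-unique (≤-trans (s≤s z≤n) 3≤p) p≤ℓ c∈′ x∈ refl refl)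
    where
    c∈′ : InCols (a ! p) (col x)
    c∈′ = proj₁ (proj₂ (positive x∈)) , col≤content x∈
    c∈ : InCols α₂ (col x)
    c∈ = subst (λ m → InCols m (col x)) aₚ≡α₂ c∈′

  countRow≡ : ∀ r → countRow r T ≡ countCols (λ c → row₂ c ≡ᵇ r) α₁ + countCols (λ c → rowₚ c ≡ᵇ r) α₂
  countRow≡ r = trans (count-+ _ in₂ inₚ T split)
    (cong₂ _+_ (count-upTo 2 (_≡ᵇ r) α₁ (s≤s z≤n) 2≤ℓ (≤-reflexive (sym a₂≡α₁)))
               (count-upTo p (_≡ᵇ r) α₂ (≤-trans (s≤s z≤n) 3≤p) p≤ℓ (≤-reflexive (sym aₚ≡α₂))))
    where
    in₂ inₚ : Cell → Bool
    in₂ x = ((ent x ≡ᵇ 2) ∧ (col x ≤ᵇ α₁)) ∧ (row x ≡ᵇ r)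
    inₚ x = ((ent x ≡ᵇ p) ∧ (col x ≤ᵇ α₂)) ∧ (row x ≡ᵇ r)
    split : ∀ {x} → x ∈ T → ⟦ row x ≡ᵇ r ⟧ ≡ ⟦ in₂ x ⟧ + ⟦ inₚ x ⟧
    split x∈ with classify x∈
    ... | inj₁ (refl , (_ , c≤α₁) , _) rewrite ≢⇒≡ᵇ-false {2} {p} (λ 2≡p → p≢2 (sym 2≡p)) | ≤⇒≤ᵇ-true c≤α₁ =
      sym (+-identityʳ _)
    ... | inj₂ (refl , (_ , c≤α₂) , _) rewrite ≢⇒≡ᵇ-false p≢2 | ≤⇒≤ᵇ-true c≤α₂ | ≡⇒≡ᵇ-true {p} refl = refl

  open RowDataTheory α₁ α₂ ℓ using (RowData; InRow)

  row₂-range : ∀ {c} → InCols α₁ c → 1 ≤ row₂ c × row₂ c ≤ 2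
  row₂-range c∈ = proj₁ (positive (cell₂-∈ c∈)) , row≤ent (cell₂-∈ c∈)

  rowₚ-range : ∀ {c} → InCols α₂ c → 1 ≤ rowₚ c × rowₚ c ≤ ℓ
  rowₚ-range c∈ = proj₁ (positive (cellₚ-∈ c∈)) , ≤-trans (row≤ent (cellₚ-∈ c∈)) p≤ℓ

  antitone : ∀ {e α} → (∀ {c} → InCols α c → (rowOf e c , c , e) ∈ T) → AntitoneOn α (rowOf e)
  antitone cell-∈ {c} {c′} 1≤c c≤c′ c′≤α with m≤n⇒m<n∨m≡n c≤c′
  ... | inj₁ c<c′ = descend (cell-∈ (1≤c , ≤-trans c≤c′ c′≤α)) (cell-∈ (≤-trans 1≤c c≤c′ , c′≤α)) refl c<c′
  ... | inj₂ refl = ≤-refl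

  row₂≢rowₚ : ∀ {c} → InCols α₁ c → c ≤ α₂ → row₂ c ≢ rowₚ c
  row₂≢rowₚ c∈@(1≤c , _) c≤α₂ row≡ =
    p≢2 (sym (cong ent (unique-pos⇒≡ distinct-positions (cell₂-∈ c∈) (cellₚ-∈ (1≤c , c≤α₂)) (cong (_, _) row≡))))

  kohnert : ∀ {c} → InCols α₁ c → c ≤ α₂ → row₂ c ≡ 2 → rowₚ c ≡ 1 → suc c ≤ α₁ × row₂ (suc c) ≡ 2
  kohnert {c} c∈@(1≤c , _) c≤α₂ row₂≡2 rowₚ≡1
    with ruleIV (cell₂-∈ c∈) (cellₚ-∈ (1≤c , c≤α₂)) 3≤p refl (subst₂ _<_ (sym rowₚ≡1) (sym row₂≡2) ≤-refl)
  ... | z , z∈ , refl , col≡ , 1<row with classify z∈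
  ...   | inj₂ (p≡2 , _) = ⊥-elim (p≢2 (sym p≡2))
  ...   | inj₁ (_ , (_ , col≤α₁) , row≡) =
    c<α₁ , ≤-antisym (proj₂ (row₂-range (s≤s z≤n , c<α₁))) (subst (2 ≤_) (trans row≡ (cong row₂ col≡)) (subst (_< row z) rowₚ≡1 1<row))
    where
    c<α₁ : suc c ≤ α₁
    c<α₁ = subst (_≤ α₁) col≡ col≤α₁

  yamanouchi₂ : ∀ {c} → InCols α₂ c → rowₚ c ≡ 2 → Σ ℕ λ c₂ → InCols α₁ c₂ × row₂ c₂ ≡ 2
  yamanouchi₂ c∈ rowₚ≡2 with proj₂ Q 2 (_ , cellₚ-∈ c∈ , rowₚ≡2)
  ... | inj₁ (x , x∈ , row≡2 , ent≡2) with classify x∈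
  ...   | inj₁ (_ , c∈′ , row≡) = col x , c∈′ , trans (sym row≡) row≡2
  ...   | inj₂ (ent≡p , _) = ⊥-elim (p≢2 (trans (sym ent≡p) ent≡2))
  yamanouchi₂ c∈ rowₚ≡2 | inj₂ (x , y , x∈ , y∈ , row≡2 , row≡3 , col≤) with classify y∈
  ... | inj₁ (ent≡2 , _) = ⊥-elim (1+n≰n (subst₂ _≤_ row≡3 ent≡2 (row≤ent y∈)))
  ... | inj₂ (_ , (_ , y≤α₂) , rowy≡) with classify x∈
  ...   | inj₁ (_ , c∈′ , row≡) = col x , c∈′ , trans (sym row≡) row≡2
  ...   | inj₂ (_ , (1≤x , _) , rowx≡) =
    ⊥-elim (1+n≰n (subst₂ _≤_ (trans (sym rowy≡) row≡3) (trans (sym rowx≡) row≡2) (antitone cellₚ-∈ 1≤x col≤ y≤α₂)))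

  inRow : ∀ {x} → x ∈ T → InRow row₂ rowₚ (row x) (col x)
  inRow x∈ with classify x∈
  ... | inj₁ (_ , c∈ , row≡) = inj₁ (c∈ , sym row≡)
  ... | inj₂ (_ , c∈ , row≡) = inj₂ (c∈ , sym row≡)

  yamanouchi₁ : ∀ {c} → InCols α₂ c → rowₚ c ≡ 1 →
    Σ ℕ λ c₁ → Σ ℕ λ c₂ → c₁ ≤ c₂ × InRow row₂ rowₚ 1 c₁ × InRow row₂ rowₚ 2 c₂
  yamanouchi₁ c∈ rowₚ≡1 with proj₂ Q 1 (_ , cellₚ-∈ c∈ , rowₚ≡1)
  ... | inj₁ (x , x∈ , _ , ent≡1) with ent≡2⊎p x∈
  ...   | inj₁ ent≡2 = ⊥-elim (1+n≰n (≤-reflexive (trans (sym ent≡2) ent≡1)))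
  ...   | inj₂ ent≡p = ⊥-elim (<⇒≱ (≤-trans (s≤s (s≤s z≤n)) 3≤p) (≤-reflexive (trans (sym ent≡p) ent≡1)))
  yamanouchi₁ c∈ rowₚ≡1 | inj₂ (x , y , x∈ , y∈ , refl , row≡2 , col≤) =
    col x , col y , col≤ , inRow x∈ , subst (λ r → InRow row₂ rowₚ r (col y)) row≡2 (inRow y∈)

  rowData : RowData
  rowData = record
    { row₂ = row₂ ; rowₚ = rowₚ
    ; row₂-range = row₂-range ; rowₚ-range = rowₚ-range
    ; row₂-antitone = antitone cell₂-∈ ; rowₚ-antitone = antitone cellₚ-∈
    ; row₂≢rowₚ = row₂≢rowₚ ; kohnert = kohnert
    ; yamanouchi₂ = yamanouchi₂ ; yamanouchi₁ = yamanouchi₁ }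

module FromRows {a : List ℕ} (A : TwoParts a) (row₂ rowₚ : ℕ → ℕ) where
  open TwoParts A

  cell₂ cellₚ : ℕ → Cell
  cell₂ c = (row₂ c , c , 2)
  cellₚ c = (rowₚ c , c , p)

  cells : Filling
  cells = map cell₂ (cols α₁) ++ map cellₚ (cols α₂)

  Occupied : ℕ → ℕ → ℕ → Set
  Occupied r c e = (e ≡ 2 × InCols α₁ c × row₂ c ≡ r) ⊎ (e ≡ p × InCols α₂ c × rowₚ c ≡ r)

  ∈-cells⁻ : ∀ {x} → x ∈ cells → Occupied (row x) (col x) (ent x)
  ∈-cells⁻ x∈ with ∈-++⁻ (map cell₂ (cols α₁)) x∈
  ... | inj₁ x∈₂ with ∈-map⁻ cell₂ x∈₂
  ...   | c , c∈ , refl = inj₁ (refl , ∈-cols⁻ α₁ c∈ , refl)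
  ∈-cells⁻ x∈ | inj₂ x∈ₚ with ∈-map⁻ cellₚ x∈ₚ
  ...   | c , c∈ , refl = inj₂ (refl , ∈-cols⁻ α₂ c∈ , refl)

  ∈-cells⁺ : ∀ {r c e} → Occupied r c e → (r , c , e) ∈ cells
  ∈-cells⁺ (inj₁ (refl , c∈ , refl)) = ∈-++⁺ˡ (∈-map⁺ cell₂ (∈-cols⁺ α₁ c∈))
  ∈-cells⁺ (inj₂ (refl , c∈ , refl)) = ∈-++⁺ʳ (map cell₂ (cols α₁)) (∈-map⁺ cellₚ (∈-cols⁺ α₂ c∈))

  countRow-cells : ∀ r → countRow r cells ≡ countCols (λ c → row₂ c ≡ᵇ r) α₁ + countCols (λ c → rowₚ c ≡ᵇ r) α₂
  countRow-cells r = trans (count-++ _ (map cell₂ (cols α₁)) _) (cong₂ _+_ (count-map-cols _ cell₂ α₁) (count-map-cols _ cellₚ α₂))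

  module _ (row₂-range    : ∀ {c} → InCols α₁ c → 1 ≤ row₂ c × row₂ c ≤ 2)
           (rowₚ-range    : ∀ {c} → InCols α₂ c → 1 ≤ rowₚ c × rowₚ c ≤ p)
           (row₂-antitone : AntitoneOn α₁ row₂)
           (rowₚ-antitone : AntitoneOn α₂ rowₚ)
           (row₂≢rowₚ     : ∀ {c} → InCols α₁ c → c ≤ α₂ → row₂ c ≢ rowₚ c)
           (kohnert       : ∀ {c} → InCols α₁ c → c ≤ α₂ → row₂ c ≡ 2 → rowₚ c ≡ 1 →
                            suc c ≤ α₁ × row₂ (suc c) ≡ 2)
           (yamanouchi    : ∀ {r c e} → Occupied r c e → (Σ ℕ λ c′ → Occupied r c′ r) ⊎
                            (Σ ℕ λ c₁ → Σ ℕ λ e₁ → Σ ℕ λ c₂ → Σ ℕ λ e₂ →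
                               Occupied r c₁ e₁ × Occupied (suc r) c₂ e₂ × c₁ ≤ c₂))
           where

    private
      1≤p : 1 ≤ p
      1≤p = ≤-trans (s≤s z≤n) 3≤p

      2<p : 2 < p
      2<p = 3≤p

    distinct-positions : Unique (map pos cells)
    distinct-positions rewrite map-++ pos (map cell₂ (cols α₁)) (map cellₚ (cols α₂))
                             | sym (map-∘ {g = pos} {f = cell₂} (cols α₁))
                             | sym (map-∘ {g = pos} {f = cellₚ} (cols α₂)) =
      Unique.++⁺ (Unique.map⁺ (cong proj₂) (cols-unique α₁)) (Unique.map⁺ (cong proj₂) (cols-unique α₂)) disjoint
      where
      disjoint : ∀ {v} → ¬ (v ∈ map (λ c → row₂ c , c) (cols α₁) × v ∈ map (λ c → rowₚ c , c) (cols α₂))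
      disjoint (v∈₂ , v∈ₚ) with ∈-map⁻ (λ c → row₂ c , c) v∈₂ | ∈-map⁻ (λ c → rowₚ c , c) v∈ₚ
      ... | c , c∈₂ , refl | c′ , c′∈ₚ , e with cong proj₂ e
      ...   | refl = row₂≢rowₚ (∈-cols⁻ α₁ c∈₂) (proj₂ (∈-cols⁻ α₂ c′∈ₚ)) (cong proj₁ e)

    countEnt-cells : ∀ i → countEnt i cells ≡ a ! i
    countEnt-cells i = trans (count-++ _ (map cell₂ (cols α₁)) _)
      (trans (cong₂ _+_ (count-map-cols _ cell₂ α₁) (count-map-cols _ cellₚ α₂)) by-entry)
      where
      by-entry : countCols (λ _ → 2 ≡ᵇ i) α₁ + countCols (λ _ → p ≡ᵇ i) α₂ ≡ a ! i
      by-entry with i ≟ 2 | i ≟ p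
      ... | yes refl | _ rewrite ≢⇒≡ᵇ-false p≢2 =
        trans (cong₂ _+_ (countCols-all _ α₁ (λ _ → refl)) (countCols-none _ α₂ (λ _ → refl))) (trans (+-identityʳ α₁) (sym a₂≡α₁))
      ... | no _ | yes refl rewrite ≢⇒≡ᵇ-false {2} {p} (λ 2≡p → p≢2 (sym 2≡p)) | ≡⇒≡ᵇ-true {p} refl =
        trans (cong₂ _+_ (countCols-none _ α₁ (λ _ → refl)) (countCols-all _ α₂ (λ _ → refl))) (sym aₚ≡α₂)
      ... | no i≢2 | no i≢p rewrite ≢⇒≡ᵇ-false {2} {i} (λ 2≡i → i≢2 (sym 2≡i)) | ≢⇒≡ᵇ-false {p} {i} (λ p≡i → i≢p (sym p≡i))
                                  | a-zero i i≢2 i≢p =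
        cong₂ _+_ (countCols-none _ α₁ (λ _ → refl)) (countCols-none _ α₂ (λ _ → refl))

    countEntCol-cells : ∀ i c → 1 ≤ c → c ≤ a ! i → countEntCol i c cells ≡ 1
    countEntCol-cells i c 1≤c c≤aᵢ = trans (count-++ _ (map cell₂ (cols α₁)) _)
      (trans (cong₂ _+_ (count-map-cols _ cell₂ α₁) (count-map-cols _ cellₚ α₂)) by-entry)
      where
      by-entry : countCols (λ c′ → (2 ≡ᵇ i) ∧ (c′ ≡ᵇ c)) α₁ + countCols (λ c′ → (p ≡ᵇ i) ∧ (c′ ≡ᵇ c)) α₂ ≡ 1
      by-entry with i ≟ 2 | i ≟ p
      ... | yes refl | _ rewrite ≢⇒≡ᵇ-false p≢2 =
        cong₂ _+_ (countCols-point α₁ (1≤c , subst (c ≤_) a₂≡α₁ c≤aᵢ)) (countCols-none _ α₂ (λ _ → refl))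
      ... | no _ | yes refl rewrite ≢⇒≡ᵇ-false {2} {p} (λ 2≡p → p≢2 (sym 2≡p)) | ≡⇒≡ᵇ-true {p} refl =
        cong₂ _+_ (countCols-none _ α₁ (λ _ → refl)) (countCols-point α₂ (1≤c , subst (c ≤_) aₚ≡α₂ c≤aᵢ))
      ... | no i≢2 | no i≢p = ⊥-elim (1+n≰n (≤-trans 1≤c (subst (c ≤_) (a-zero i i≢2 i≢p) c≤aᵢ)))

    positive : ∀ {x} → x ∈ cells → 1 ≤ row x × 1 ≤ col x × 1 ≤ ent x
    positive x∈ with ∈-cells⁻ x∈
    ... | inj₁ (refl , c∈@(1≤c , _) , refl) = proj₁ (row₂-range c∈) , 1≤c , s≤s z≤n
    ... | inj₂ (refl , c∈@(1≤c , _) , refl) = proj₁ (rowₚ-range c∈) , 1≤c , 1≤p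

    ent≤ℓ : ∀ {x} → x ∈ cells → ent x ≤ length a
    ent≤ℓ x∈ with ∈-cells⁻ x∈
    ... | inj₁ (refl , _) = 2≤ℓ
    ... | inj₂ (refl , _) = p≤ℓ

    row≤ent : ∀ {x} → x ∈ cells → row x ≤ ent x
    row≤ent x∈ with ∈-cells⁻ x∈
    ... | inj₁ (refl , c∈ , refl) = proj₂ (row₂-range c∈)
    ... | inj₂ (refl , c∈ , refl) = proj₂ (rowₚ-range c∈)

    descend : ∀ {x y} → x ∈ cells → y ∈ cells → ent x ≡ ent y → col x < col y → row y ≤ row x
    descend x∈ y∈ ent≡ col< with ∈-cells⁻ x∈ | ∈-cells⁻ y∈
    ... | inj₁ (refl , (1≤c , _) , refl) | inj₁ (refl , (_ , c′≤α₁) , refl) = row₂-antitone 1≤c (<⇒≤ col<) c′≤α₁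
    ... | inj₂ (refl , (1≤c , _) , refl) | inj₂ (refl , (_ , c′≤α₂) , refl) = rowₚ-antitone 1≤c (<⇒≤ col<) c′≤α₂
    ... | inj₁ (refl , _) | inj₂ (refl , _) = ⊥-elim (p≢2 (sym ent≡))
    ... | inj₂ (refl , _) | inj₁ (refl , _) = ⊥-elim (p≢2 ent≡)

    2-above-p : ∀ {c} → InCols α₁ c → c ≤ α₂ → rowₚ c < row₂ c → suc c ≤ α₁ × rowₚ c < row₂ (suc c)
    2-above-p {c} c∈@(1≤c , _) c≤α₂ rowₚ<row₂ =
      proj₁ next , subst (rowₚ c <_) (sym (proj₂ next)) (≤-trans rowₚ<row₂ (proj₂ (row₂-range c∈)))
      where
      1≤rowₚ : 1 ≤ rowₚ c
      1≤rowₚ = proj₁ (rowₚ-range (1≤c , c≤α₂))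
      row₂≡2 : row₂ c ≡ 2
      row₂≡2 = ≤-antisym (proj₂ (row₂-range c∈)) (≤-trans (s≤s 1≤rowₚ) rowₚ<row₂)
      rowₚ≡1 : rowₚ c ≡ 1
      rowₚ≡1 = ≤-antisym (≤-pred (subst (rowₚ c <_) row₂≡2 rowₚ<row₂)) 1≤rowₚ
      next : suc c ≤ α₁ × row₂ (suc c) ≡ 2
      next = kohnert c∈ c≤α₂ row₂≡2 rowₚ≡1

    ruleIV : ∀ {x y} → x ∈ cells → y ∈ cells → ent x < ent y → col x ≡ col y → row y < row x →
             ∃[ z ] (z ∈ cells × ent z ≡ ent x × col z ≡ suc (col y) × row y < row z)
    ruleIV x∈ y∈ ent< col≡ row< with ∈-cells⁻ x∈ | ∈-cells⁻ y∈
    ... | inj₁ (refl , _) | inj₁ (refl , _) = ⊥-elim (<-irrefl refl ent<)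
    ... | inj₂ (refl , _) | inj₂ (refl , _) = ⊥-elim (<-irrefl refl ent<)
    ... | inj₂ (refl , _) | inj₁ (refl , _) = ⊥-elim (<-asym ent< 2<p)
    ... | inj₁ (refl , c∈ , refl) | inj₂ (refl , (_ , c≤α₂) , refl) with col≡
    ...   | refl with 2-above-p c∈ c≤α₂ row<
    ...     | c<α₁ , rowₚ<row₂ = cell₂ (suc _) , ∈-cells⁺ (inj₁ (refl , (s≤s z≤n , c<α₁) , refl)) , refl , refl , rowₚ<row₂

    quasiYamanouchi : IsQuasiYamanouchi cells
    quasiYamanouchi r (x , x∈ , refl) with yamanouchi (∈-cells⁻ x∈)
    ... | inj₁ (c′ , occ) = inj₁ (_ , ∈-cells⁺ occ , refl , refl)
    ... | inj₂ (c₁ , e₁ , c₂ , e₂ , occ₁ , occ₂ , c₁≤c₂) = inj₂ (_ , _ , ∈-cells⁺ occ₁ , ∈-cells⁺ occ₂ , refl , refl , c₁≤c₂)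

    cells-QKT : QKT a cells
    cells-QKT = ((distinct-positions , positive) , ent≤ℓ , (λ i _ _ → countEnt-cells i)
                , (λ i _ _ c 1≤c c≤aᵢ → countEntCol-cells i c 1≤c c≤aᵢ) , row≤ent , descend , ruleIV)
              , quasiYamanouchi

-- Two tableaux of equal weight when 3 ≤ α₁ < α₂

step : ℕ → ℕ → (ℕ → ℕ) → ℕ → ℕ
step k v f c with c <? k
... | yes _ = v
... | no  _ = f c

step-< : ∀ {k v f c} → c < k → step k v f c ≡ v
step-< {k} {c = c} c<k with c <? k
... | yes _   = refl
... | no  c≮k = ⊥-elim (c≮k c<k)

step-≥ : ∀ {k v f c} → k ≤ c → step k v f c ≡ f c
step-≥ {k} {c = c} k≤c with c <? k
... | yes c<k = ⊥-elim (<⇒≱ c<k k≤c)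
... | no  _   = refl

step-cases : ∀ k v f c → (c < k × step k v f c ≡ v) ⊎ (k ≤ c × step k v f c ≡ f c)
step-cases k v f c with c <? k
... | yes c<k = inj₁ (c<k , refl)
... | no  c≮k = inj₂ (≮⇒≥ c≮k , refl)

step-within : ∀ {lo hi} k v f c → lo ≤ v × v ≤ hi → (∀ c → lo ≤ f c × f c ≤ hi) → lo ≤ step k v f c × step k v f c ≤ hi
step-within k v f c v-within f-within with step-cases k v f c
... | inj₁ (_ , e) rewrite e = v-within
... | inj₂ (_ , e) rewrite e = f-within c

Antitone : (ℕ → ℕ) → Set
Antitone f = ∀ {c c′} → c ≤ c′ → f c′ ≤ f c

step-antitone : ∀ k v f → (∀ c → f c ≤ v) → Antitone f → Antitone (step k v f)
step-antitone k v f f≤v f-antitone {c} {c′} c≤c′ with step-cases k v f c | step-cases k v f c′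
... | inj₁ (_ , e) | inj₁ (_ , e′) = ≤-reflexive (trans e′ (sym e))
... | inj₁ (_ , e) | inj₂ (_ , e′) = subst₂ _≤_ (sym e′) (sym e) (f≤v c′)
... | inj₂ (k≤c , _) | inj₁ (c′<k , _) = ⊥-elim (<⇒≱ c′<k (≤-trans k≤c c≤c′))
... | inj₂ (_ , e) | inj₂ (_ , e′) = subst₂ _≤_ (sym e′) (sym e) (f-antitone c≤c′)

step-suc-agree : ∀ {k v f} c → c ≢ k → step (suc k) v f c ≡ step k v f c
step-suc-agree {k} c c≢k with step-cases k _ _ c | step-cases (suc k) _ _ c
... | inj₁ (_ , e) | inj₁ (_ , e′) = trans e′ (sym e)
... | inj₁ (c<k , _) | inj₂ (k<c , _) = ⊥-elim (<-asym c<k (≤-trans (n<1+n k) k<c))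
... | inj₂ (k≤c , _) | inj₁ (c<1+k , _) = ⊥-elim (c≢k (≤-antisym (≤-pred c<1+k) k≤c))
... | inj₂ (_ , e) | inj₂ (_ , e′) = trans e′ (sym e)

step-cong : ∀ {k v f g} c → f c ≡ g c → step k v f c ≡ step k v g c
step-cong {k} c fc≡gc with c <? k
... | yes _ = refl
... | no  _ = fc≡gc

+-exchange : ∀ A B C D {x y} → A + x ≡ C + y → B + y ≡ D + x → A + B ≡ C + D
+-exchange A B C D {x} {y} e₁ e₂ = +-cancelʳ-≡ (x + y) _ _ (begin
  (A + B) + (x + y)   ≡⟨ interchange A B x y ⟩
  (A + x) + (B + y)   ≡⟨ cong₂ _+_ e₁ e₂ ⟩
  (C + y) + (D + x)   ≡⟨ interchange C y D x ⟩
  (C + D) + (y + x)   ≡⟨ cong ((C + D) +_) (+-comm y x) ⟩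
  (C + D) + (x + y)   ∎)
  where open ≡-Reasoning

module Staircase {a : List ℕ} (A : TwoParts a) (3≤α₁ : 3 ≤ TwoParts.α₁ A) (α₁<α₂ : TwoParts.α₁ A < TwoParts.α₂ A) where
  open TwoParts A

  one : ℕ → ℕ
  one _ = 1

  stair₂ stairₚ : ℕ → ℕ → ℕ
  stair₂ k = step k 2 one
  stairₚ j = step α₁ p (step j 2 one)

  private
    2≤p : 2 ≤ p
    2≤p = ≤-trans (n≤1+n 2) 3≤p

    one-within : ∀ {hi} → 1 ≤ hi → ∀ c → 1 ≤ one c × one c ≤ hi
    one-within 1≤hi _ = ≤-refl , 1≤hi

    stair₂-within : ∀ k c → 1 ≤ stair₂ k c × stair₂ k c ≤ 2
    stair₂-within k c = step-within k 2 one c (s≤s z≤n , ≤-refl) (one-within (s≤s z≤n))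

    below-within : ∀ j c → 1 ≤ step j 2 one c × step j 2 one c ≤ p
    below-within j c = step-within j 2 one c (s≤s z≤n , 2≤p) (one-within (≤-trans (s≤s z≤n) 2≤p))

    stairₚ-within : ∀ j c → 1 ≤ stairₚ j c × stairₚ j c ≤ p
    stairₚ-within j c = step-within α₁ p (step j 2 one) c (≤-trans (s≤s z≤n) 2≤p , ≤-refl) (below-within j)

    stair₂-antitone : ∀ k → Antitone (stair₂ k)
    stair₂-antitone k = step-antitone k 2 one (λ c → proj₂ (one-within (s≤s z≤n) c)) (λ _ → ≤-refl)

    stairₚ-antitone : ∀ j → Antitone (stairₚ j)
    stairₚ-antitone j = step-antitone α₁ p (step j 2 one) (λ c → proj₂ (below-within j c))
                          (step-antitone j 2 one (λ c → proj₂ (one-within (s≤s z≤n) c)) (λ _ → ≤-refl))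

  module Tableau {k j} (2≤k : 2 ≤ k) (k≤α₁ : k ≤ α₁) (α₁<j : α₁ < j) where
    open FromRows A (stair₂ k) (stairₚ j) public

    stairₚ≢1 : ∀ {c} → c ≤ α₁ → stairₚ j c ≢ 1
    stairₚ≢1 {c} c≤α₁ with step-cases α₁ p (step j 2 one) c
    ... | inj₁ (_ , e) = λ e′ → 1+n≰n (≤-trans 2≤p (≤-reflexive (trans (sym e) e′)))
    ... | inj₂ (_ , e) = λ e′ → 1+n≰n (≤-reflexive (trans (sym (step-< {j} {2} {one} (≤-<-trans c≤α₁ α₁<j))) (trans (sym e) e′)))

    occupied-rows : ∀ {r c e} → Occupied r c e → r ≡ 1 ⊎ r ≡ 2 ⊎ r ≡ p
    occupied-rows (inj₁ (_ , _ , refl)) with step-cases k 2 one _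
    ... | inj₁ (_ , e) = inj₂ (inj₁ e)
    ... | inj₂ (_ , e) = inj₁ e
    occupied-rows (inj₂ (_ , _ , refl)) with step-cases α₁ p (step j 2 one) _
    ... | inj₁ (_ , e) = inj₂ (inj₂ e)
    ... | inj₂ (_ , e) with step-cases j 2 one _
    ...   | inj₁ (_ , e′) = inj₂ (inj₁ (trans e e′))
    ...   | inj₂ (_ , e′) = inj₁ (trans e e′)

    stair-QKT : QKT a cells
    stair-QKT = cells-QKT (λ {c} _ → stair₂-within k c) (λ {c} _ → stairₚ-within j c)
      (λ _ c≤c′ _ → stair₂-antitone k c≤c′) (λ _ c≤c′ _ → stairₚ-antitone j c≤c′)
      row₂≢rowₚ (λ (_ , c≤α₁) _ _ rowₚ≡1 → ⊥-elim (stairₚ≢1 c≤α₁ rowₚ≡1)) yamanouchi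
      where
      row₂≢rowₚ : ∀ {c} → InCols α₁ c → c ≤ α₂ → stair₂ k c ≢ stairₚ j c
      row₂≢rowₚ {c} (_ , c≤α₁) _ with step-cases k 2 one c
      ... | inj₁ (c<k , e) = λ e′ → p≢2 (trans (sym (step-< {α₁} {p} {step j 2 one} (<-≤-trans c<k k≤α₁))) (trans (sym e′) e))
      ... | inj₂ (_ , e) = λ e′ → stairₚ≢1 c≤α₁ (trans (sym e′) e)
      yamanouchi : ∀ {r c e} → Occupied r c e → (Σ ℕ λ c′ → Occupied r c′ r) ⊎
                   (Σ ℕ λ c₁ → Σ ℕ λ e₁ → Σ ℕ λ c₂ → Σ ℕ λ e₂ → Occupied r c₁ e₁ × Occupied (suc r) c₂ e₂ × c₁ ≤ c₂)
      yamanouchi occ with occupied-rows occ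
      ... | inj₁ refl = inj₂ (α₁ , 2 , α₁ , p , inj₁ (refl , (1≤α₁ , ≤-refl) , step-≥ k≤α₁) ,
                               inj₂ (refl , (1≤α₁ , <⇒≤ α₁<α₂) , trans (step-≥ {α₁} {p} {step j 2 one} ≤-refl) (step-< {j} {2} {one} α₁<j)) , ≤-refl)
      ... | inj₂ (inj₁ refl) = inj₁ (1 , inj₁ (refl , (s≤s z≤n , 1≤α₁) , step-< 2≤k))
      ... | inj₂ (inj₂ refl) = inj₁ (1 , inj₂ (refl , (s≤s z≤n , ≤-trans 1≤α₁ (<⇒≤ α₁<α₂)) , step-< (≤-trans (s≤s (s≤s z≤n)) 3≤α₁)))

  -- Second arises from First by moving the 2 of column α₁ - 1 down to row 1 and
  -- the p of column α₁ + 1 up to row 2, which keeps every row count.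
  private
    k : ℕ
    k = pred α₁

    1+k≡α₁ : suc k ≡ α₁
    1+k≡α₁ = suc-pred α₁ ⦃ >-nonZero 1≤α₁ ⦄

    2≤k : 2 ≤ k
    2≤k = ≤-pred (subst (3 ≤_) (sym 1+k≡α₁) 3≤α₁)

    k∈ : InCols α₁ k
    k∈ = ≤-trans (s≤s z≤n) 2≤k , subst (k ≤_) 1+k≡α₁ (n≤1+n k)

  module First  = Tableau {suc k} {suc α₁}       (≤-trans 2≤k (n≤1+n k)) (≤-reflexive 1+k≡α₁) (n<1+n α₁)
  module Second = Tableau {k}     {suc (suc α₁)} 2≤k (proj₂ k∈) (m≤n⇒m≤1+n (n<1+n α₁))

  same-weight : wt a First.cells ≡ wt a Second.cells
  same-weight = map-cong same-row (oneTo (length a))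
    where
    same-row : ∀ r → countRow r First.cells ≡ countRow r Second.cells
    same-row r = trans (First.countRow-cells r)
      (trans (+-exchange (in₂ (suc k)) (inₚ (suc α₁)) (in₂ k) (inₚ (suc (suc α₁))) moved₂ movedₚ)
             (sym (Second.countRow-cells r)))
      where
      in₂ inₚ : ℕ → ℕ
      in₂ k′ = countCols (λ c → stair₂ k′ c ≡ᵇ r) α₁
      inₚ j′ = countCols (λ c → stairₚ j′ c ≡ᵇ r) α₂
      moved₂ : in₂ (suc k) + ⟦ 1 ≡ᵇ r ⟧ ≡ in₂ k + ⟦ 2 ≡ᵇ r ⟧
      moved₂ = subst₂ (λ u v → in₂ (suc k) + ⟦ u ≡ᵇ r ⟧ ≡ in₂ k + ⟦ v ≡ᵇ r ⟧)
                 (step-≥ {k} {2} {one} ≤-refl) (step-< {suc k} {2} {one} (n<1+n k))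
                 (countCols-swap _ _ α₁ k∈ (λ c c≢k → cong (_≡ᵇ r) (step-suc-agree {k} {2} {one} c c≢k)))
      movedₚ : inₚ (suc α₁) + ⟦ 2 ≡ᵇ r ⟧ ≡ inₚ (suc (suc α₁)) + ⟦ 1 ≡ᵇ r ⟧
      movedₚ = subst₂ (λ u v → inₚ (suc α₁) + ⟦ u ≡ᵇ r ⟧ ≡ inₚ (suc (suc α₁)) + ⟦ v ≡ᵇ r ⟧)
                 (trans (step-≥ {α₁} {p} {step (suc (suc α₁)) 2 one} (n≤1+n α₁)) (step-< {suc (suc α₁)} {2} {one} ≤-refl))
                 (trans (step-≥ {α₁} {p} {step (suc α₁) 2 one} (n≤1+n α₁)) (step-≥ {suc α₁} {2} {one} ≤-refl))
                 (countCols-swap _ _ α₂ (s≤s z≤n , α₁<α₂)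
                   (λ c c≢j → cong (_≡ᵇ r) (step-cong {α₁} {p} c (sym (step-suc-agree {suc α₁} {2} {one} c c≢j)))))

  different : ¬ SameTableau First.cells Second.cells
  different same with Second.∈-cells⁻ (proj₁ (same (2 , k , 2)) (First.∈-cells⁺ (inj₁ (refl , k∈ , step-< {suc k} {2} {one} (n<1+n k)))))
  ... | inj₁ (_ , _ , row≡2) = 1+n≰n (≤-reflexive (trans (sym row≡2) (step-≥ {k} {2} {one} ≤-refl)))
  ... | inj₂ (2≡p , _) = p≢2 (sym 2≡p)

  not-multiplicityFree : ¬ MultiplicityFree a
  not-multiplicityFree mf = different (mf _ _ First.stair-QKT Second.stair-QKT same-weight)

SortCondition : List ℕ → Set
SortCondition a =
  sort a ≡ 3 ∷ 3 ∷ [] ⊎ sort a ≡ 4 ∷ 4 ∷ [] ⊎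
  (∃[ n ] (4 ≤ n × sort a ≡ (n ∸ 2) ∷ 2 ∷ [])) ⊎
  (∃[ n ] (2 ≤ n × sort a ≡ (n ∸ 1) ∷ 1 ∷ []))

FlatCondition : List ℕ → Set
FlatCondition a = ∃[ α₁ ] ∃[ α₂ ] (flat a ≡ α₁ ∷ α₂ ∷ [] × α₂ ≤ α₁)

module _ {a : List ℕ} (A : TwoParts a) where
  open TwoParts A

  sameRows⇒⊆ : ∀ {T T′} (Q : QKT a T) (Q′ : QKT a T′) →
    (∀ {c} → InCols α₁ c → FromTableau.row₂ A Q c ≡ FromTableau.row₂ A Q′ c) →
    (∀ {c} → InCols α₂ c → FromTableau.rowₚ A Q c ≡ FromTableau.rowₚ A Q′ c) →
    ∀ {x} → x ∈ T → x ∈ T′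
  sameRows⇒⊆ Q Q′ row₂≡ rowₚ≡ x∈ with FromTableau.classify A Q x∈
  ... | inj₁ (refl , c∈ , refl) rewrite row₂≡ c∈ = FromTableau.cell₂-∈ A Q′ c∈
  ... | inj₂ (refl , c∈ , refl) rewrite rowₚ≡ c∈ = FromTableau.cellₚ-∈ A Q′ c∈

  multiplicityFree : α₂ ≤ α₁ ⊎ α₁ ≤ 2 → MultiplicityFree a
  multiplicityFree shape T T′ Q Q′ wt≡ x =
    sameRows⇒⊆ Q Q′ row₂≡ rowₚ≡ , sameRows⇒⊆ Q′ Q (λ c∈ → sym (row₂≡ c∈)) (λ c∈ → sym (rowₚ≡ c∈))
    where
    module E  = FromTableau A Q
    module E′ = FromTableau A Q′
    open RowDataTheory α₁ α₂ (length a)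
    same-weight : ∀ r → 1 ≤ r → r ≤ length a → weight E.rowData r ≡ weight E′.rowData r
    same-weight r 1≤r r≤ℓ = trans (sym (E.countRow≡ r)) (trans (wt-≡⇒countRow-≡ a T T′ wt≡ r 1≤r r≤ℓ) (E′.countRow≡ r))
    row₂≡ : ∀ {c} → InCols α₁ c → E.row₂ c ≡ E′.row₂ c
    row₂≡ = row₂-determined 1≤α₂ 2≤ℓ shape E.rowData E′.rowData same-weight
    rowₚ≡ : ∀ {c} → InCols α₂ c → E.rowₚ c ≡ E′.rowₚ c
    rowₚ≡ = rowₚ-determined 1≤α₂ 2≤ℓ shape E.rowData E′.rowData same-weight

  multiplicityFree⇔ : MultiplicityFree a ⇔ (α₂ ≤ α₁ ⊎ α₁ ≤ 2)
  multiplicityFree⇔ = mk⇔ necessary multiplicityFree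
    where
    necessary : MultiplicityFree a → α₂ ≤ α₁ ⊎ α₁ ≤ 2
    necessary mf with α₂ ≤? α₁ | α₁ ≤? 2
    ... | yes α₂≤α₁ | _       = inj₁ α₂≤α₁
    ... | no  _     | yes α₁≤2 = inj₂ α₁≤2
    ... | no  α₂≰α₁ | no  α₁≰2 = ⊥-elim (Staircase.not-multiplicityFree A (≰⇒> α₁≰2) (≰⇒> α₂≰α₁) mf)

  sort≡ : α₁ < α₂ → sort a ≡ α₂ ∷ α₁ ∷ []
  sort≡ α₁<α₂ rewrite flat≡ | >⇒≤ᵇ-false {α₂} {α₁} α₁<α₂ = refl

  condition⇔ : (SortCondition a ⊎ FlatCondition a) ⇔ (α₂ ≤ α₁ ⊎ α₁ ≤ 2)
  condition⇔ = mk⇔ necessary sufficient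
    where
    sort-parts : ∀ {u v} → α₁ < α₂ → sort a ≡ u ∷ v ∷ [] → α₂ ≡ u × α₁ ≡ v
    sort-parts α₁<α₂ e with ∷-injective (trans (sym (sort≡ α₁<α₂)) e)
    ... | α₂≡u , tail≡ = α₂≡u , proj₁ (∷-injective tail≡)
    necessary : (SortCondition a ⊎ FlatCondition a) → α₂ ≤ α₁ ⊎ α₁ ≤ 2
    necessary (inj₂ (_ , _ , flat≡′ , le)) with ∷-injective (trans (sym flat≡) flat≡′)
    ... | refl , tail≡ with ∷-injective tail≡
    ...   | refl , _ = inj₁ le
    necessary (inj₁ c) with α₂ ≤? α₁
    ... | yes α₂≤α₁ = inj₁ α₂≤α₁
    ... | no  α₂≰α₁ = inj₂ (by-partition c)
      where
      α₁<α₂ : α₁ < α₂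
      α₁<α₂ = ≰⇒> α₂≰α₁
      equal-parts : ∀ {u} → sort a ≡ u ∷ u ∷ [] → α₁ ≤ 2
      equal-parts e with sort-parts α₁<α₂ e
      ... | refl , refl = ⊥-elim (α₂≰α₁ ≤-refl)
      by-partition : SortCondition a → α₁ ≤ 2
      by-partition (inj₁ e) = equal-parts e
      by-partition (inj₂ (inj₁ e)) = equal-parts e
      by-partition (inj₂ (inj₂ (inj₁ (_ , _ , e)))) = ≤-reflexive (proj₂ (sort-parts α₁<α₂ e))
      by-partition (inj₂ (inj₂ (inj₂ (_ , _ , e)))) = ≤-trans (≤-reflexive (proj₂ (sort-parts α₁<α₂ e))) (n≤1+n 1)
    sufficient : α₂ ≤ α₁ ⊎ α₁ ≤ 2 → (SortCondition a ⊎ FlatCondition a)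
    sufficient (inj₁ α₂≤α₁) = inj₂ (α₁ , α₂ , flat≡ , α₂≤α₁)
    sufficient (inj₂ α₁≤2) with α₂ ≤? α₁
    ... | yes α₂≤α₁ = inj₂ (α₁ , α₂ , flat≡ , α₂≤α₁)
    ... | no  α₂≰α₁ with m≤n⇒m<n∨m≡n α₁≤2
    ...   | inj₂ α₁≡2 = inj₁ (inj₂ (inj₂ (inj₁ (2 + α₂ , s≤s (s≤s 2≤α₂) , trans (sort≡ α₁<α₂) (cong (λ v → α₂ ∷ v ∷ []) α₁≡2)))))
      where
      α₁<α₂ : α₁ < α₂
      α₁<α₂ = ≰⇒> α₂≰α₁
      2≤α₂ : 2 ≤ α₂
      2≤α₂ = ≤-trans (≤-reflexive (sym α₁≡2)) (<⇒≤ α₁<α₂)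
    ...   | inj₁ α₁<2 = inj₁ (inj₂ (inj₂ (inj₂ (suc α₂ , s≤s 1≤α₂ , trans (sort≡ α₁<α₂) (cong (λ v → α₂ ∷ v ∷ []) α₁≡1)))))
      where
      α₁<α₂ : α₁ < α₂
      α₁<α₂ = ≰⇒> α₂≰α₁
      α₁≡1 : α₁ ≡ 1
      α₁≡1 = ≤-antisym (≤-pred α₁<2) 1≤α₁

theorem5p6 : (a : List ℕ) → nonzeroParts a ≡ 2 → a ! 1 ≡ 0 → a ! 2 ≢ 0 →
    MultiplicityFree a ⇔
      ((sort a ≡ 3 ∷ 3 ∷ [] ⊎ sort a ≡ 4 ∷ 4 ∷ [] ⊎
        (∃[ n ] (4 ≤ n × sort a ≡ (n ∸ 2) ∷ 2 ∷ [])) ⊎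
        (∃[ n ] (2 ≤ n × sort a ≡ (n ∸ 1) ∷ 1 ∷ [])))
       ⊎ (∃[ α₁ ] ∃[ α₂ ] (flat a ≡ α₁ ∷ α₂ ∷ [] × α₂ ≤ α₁)))
theorem5p6 a two-parts a₁≡0 a₂≢0 = ⇔-trans (multiplicityFree⇔ A) (⇔-sym (condition⇔ A))
  where
  A : TwoParts a
  A = twoParts a two-parts a₁≡0 a₂≢0
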